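{- Let $n \ge 0$ and let $C=\{c_1,\dots,c_{n+1}\}\subset \mathbb{Z}[i]$ be a set of $n+1$ distinct Gaussian integers. Then $C$ is $n$-universal if and only if $C$ is almost uniformly distributed modulo $p^k$ for every prime $p$ of $\mathbb{Z}[i]$ and every integer $k \ge 1$. Moreover, in that case: $|V(C)| \le |V(B)|$ for every set $B \subset \mathbb{Z}[i]$ of $n+1$ distinct elements; $V(C)$ divides $V(B)$ in $\mathbb{Z}[i]$ for every such $B$; and if such a $B$ satisfies $|V(B)| = |V(C)|$, then $B$ is also $n$-universal.
   Context: $\mathbb{Z}[i]$ is the ring of Gaussian integers; a prime means an irreducible element of $\mathbb{Z}[i]$. A polynomial $f$ with complex coefficients is integer-valued if $f(\mathbb{Z}[i])\subset\mathbb{Z}[i]$. A set $M\subset\mathbb{Z}[i]$ is $n$-universal if every polynomial $f$ with coefficients in $\mathbb{Q}(i)$ of degree at most $n$ with $f(M)\subset\mathbb{Z}[i]$ is integer-valued. For a finite set $X=\{x_1,\dots,x_k\}\subset\mathbb{Z}[i]$, its volume is $V(X)=\prod_{1\le i<j\le k}(x_i-x_j)$ (defined up to sign; $|\cdot|$ denotes complex absolute value). For $M\subset\mathbb{Z}[i]$, nonzero $\alpha\in\mathbb{Z}[i]$ and $r\in\mathbb{Z}[i]$, let $M(r \bmod \alpha)=M\cap(r+\alpha\mathbb{Z}[i])$. Non-negative integers $a_1,\dots,a_N$ are almost equal if any two of them are equal or differ by one. A finite set $M$ is almost uniformly distributed modulo a nonzero $\alpha$ if the numbers $|M(r\bmod\alpha)|$,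 as $r$ runs over all residues modulo $\alpha$, are almost equal. -}

module Defs where

open import Data.Nat as ℕ using (ℕ; zero; suc)
open import Data.Integer as ℤ using (ℤ; +_)
open import Data.Rational as ℚ using (ℚ)
open import Data.Fin using (Fin; zero; suc)
open import Data.Fin.Subset using (Subset; _∈_; ∣_∣)
open import Data.Vec using (Vec; []; _∷_)
open import Data.Product using (Σ; ∃; _×_; _,_)
open import Data.Sum using (_⊎_)
open import Data.Empty using (⊥)
open import Relation.Nullary using (¬_)
open import Relation.Binary.PropositionalEquality using (_≡_)
open import Function.Bundles using (_⇔_)

record GI : Set where
  constructor _+i_
  field
    re : ℤ
    im : ℤ
open GI public

infixl 6 _+G_ _-G_
infixl 7 _*G_

0G 1G : GI
0G = (+ 0) +i (+ 0)
1G = (+ 1) +i (+ 0)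

_+G_ _-G_ _*G_ : GI → GI → GI
(a +i b) +G (c +i d) = (a ℤ.+ c) +i (b ℤ.+ d)
(a +i b) -G (c +i d) = (a ℤ.- c) +i (b ℤ.- d)
(a +i b) *G (c +i d) = (a ℤ.* c ℤ.- b ℤ.* d) +i (a ℤ.* d ℤ.+ b ℤ.* c)

_^G_ : GI → ℕ → GI
x ^G zero  = 1G
x ^G suc k = x *G (x ^G k)

norm : GI → ℤ
norm (a +i b) = a ℤ.* a ℤ.+ b ℤ.* b

_∣G_ : GI → GI → Set
α ∣G β = ∃ λ γ → β ≡ α *G γ

IsUnit : GI → Set
IsUnit u = ∃ λ v → u *G v ≡ 1G

IsPrime : GI → Set
IsPrime p = ¬ (p ≡ 0G) × ¬ IsUnit p
          × (∀ a b → p ≡ a *G b → IsUnit a ⊎ IsUnit b)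

record QI : Set where
  constructor _+iq_
  field
    req : ℚ
    imq : ℚ
open QI public

_+Q_ _*Q_ : QI → QI → QI
(a +iq b) +Q (c +iq d) = (a ℚ.+ c) +iq (b ℚ.+ d)
(a +iq b) *Q (c +iq d) = (a ℚ.* c ℚ.- b ℚ.* d) +iq (a ℚ.* d ℚ.+ b ℚ.* c)

embed : GI → QI
embed (a +i b) = (a ℚ./ 1) +iq (b ℚ./ 1)

InGI : QI → Set
InGI q = ∃ λ z → embed z ≡ q

-- a polynomial of degree at most n over ℚ(i): coefficients c₀ … cₙ
Poly : ℕ → Set
Poly n = Vec QI (suc n)

evalV : ∀ {m} → Vec QI m → QI → QI
evalV []       z = (ℚ.0ℚ) +iq (ℚ.0ℚ)
evalV (c ∷ cs) z = c +Q (z *Q evalV cs z)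

eval : ∀ {n} → Poly n → GI → QI
eval f z = evalV f (embed z)

IntegerValued : ∀ {n} → Poly n → Set
IntegerValued f = ∀ z → InGI (eval f z)

Universal : ℕ → (GI → Set) → Set
Universal n M = ∀ (f : Poly n) → (∀ z → M z → InGI (eval f z)) → IntegerValued f

Image : ∀ {k} → (Fin k → GI) → GI → Set
Image {k} x z = ∃ λ (j : Fin k) → x j ≡ z

-- Volume V(X) = ∏_{i<j} (x_i - x_j)

prodG : ∀ {k} → (Fin k → GI) → GI
prodG {zero}  f = 1G
prodG {suc k} f = f zero *G prodG (λ j → f (suc j))

vol : ∀ {k} → (Fin k → GI) → GI
vol {zero}  x = 1G
vol {suc k} x = prodG (λ j → x zero -G x (suc j)) *G vol (λ j → x (suc j))

HasCount : ∀ {k} → (Fin k → GI) → GI → GI → ℕ → Set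
HasCount {k} x α r m =
  Σ (Subset k) λ S → (∣ S ∣ ≡ m) × (∀ j → (j ∈ S) ⇔ (α ∣G (x j -G r)))

AlmostUniform : ∀ {k} → (Fin k → GI) → GI → Set
AlmostUniform x α = ∀ r s a b → HasCount x α r a → HasCount x α s b → a ℕ.≤ suc b

-- Write π j x = ∏_{i ≠ j} (x − c i). Lagrange interpolation shows that C is n-universal iff
-- every basis polynomial π j x / π j (c j) is integer-valued, i.e. π j (c j) ∣ π j x for all x.
-- Prime by prime, v_p (π j x) = Σ_{h ≥ 1} #{i ≠ j : c i ≡ x (mod p^h)}. If all classes modulo
-- every p^h have almost equal sizes, the class of c j holds at most as many other nodes as any
-- class, which gives the divisibility. Conversely an unbalanced pair of classes yields two
-- unbalanced sibling classes inside one class modulo a lower power of p; descending along the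
-- fullest child of the one and the emptiest child of the other reaches an x with
-- v_p (π j x) < v_p (π j (c j)).
--
-- Likewise v_p (V X) = Σ_h Σ_r (|X(r mod p^h)| choose 2), and for a fixed number of points this
-- sum is minimal exactly when the class sizes are almost equal, by convexity. So V C divides V B
-- one prime power at a time, and |V B| = |V C| makes V B an associate of V C, forcing B to be
-- almost uniform as well, hence universal.

module Submission where

open import Defs
open import Data.Nat as ℕ using (ℕ; zero; suc; z≤n; s≤s; _≤_)
import Data.Nat.Properties as ℕP
import Data.Nat.Tactic.RingSolver as NS
open import Data.Integer as ℤ using (ℤ; +_; -[1+_]; +[1+_]; _+_; _*_; _-_; -_)
import Data.Integer.Properties as ℤP
import Data.Integer.DivMod as ℤD
open import Data.Integer.Tactic.RingSolver using (solve-∀)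
open import Data.Rational as ℚ using (ℚ; mkℚ; _/_; 0ℚ; 1ℚ)
import Data.Rational.Properties as ℚP
import Data.Nat.Coprimality as Cop
open import Data.Fin using (Fin; zero; suc; punchIn; punchOut)
import Data.Fin.Properties as FP
open import Data.Fin.Subset as Subset using (Subset)
open import Data.Bool using (true; false)
open import Data.Vec using (Vec; []; _∷_; here; there)
open import Data.List using (List; []; _∷_; map; _++_)
open import Data.List.Membership.Propositional using (_∈_; find; lose)
open import Data.List.Membership.Propositional.Properties using (∈-map⁺; ∈-++⁺ˡ; ∈-++⁺ʳ)
open import Data.List.Relation.Unary.All as All using (All; []; _∷_)
open import Data.List.Relation.Unary.All.Properties using (¬Any⇒All¬)
open import Data.List.Relation.Unary.AllPairs using (AllPairs; []; _∷_)
open import Data.List.Relation.Unary.Any using (Any; here; there; any?)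
open import Data.Product using (Σ; _×_; _,_; proj₁; proj₂)
open import Data.Sum using (_⊎_; inj₁; inj₂; [_,_]′)
open import Data.Empty using (⊥; ⊥-elim)
open import Relation.Nullary using (¬_; Dec; yes; no)
open import Relation.Nullary.Decidable using (dec⇒maybe; map′; decidable-stable)
open import Relation.Binary.PropositionalEquality
open import Relation.Binary.Definitions using (tri<; tri≈; tri>)
open import Function.Bundles using (_⇔_; mk⇔; Equivalence)
open import Function.Properties.Equivalence using () renaming (trans to ⇔-trans)
open import Function.Definitions using (Injective)
open import Algebra.Bundles using (CommutativeRing)
open import Algebra.Structures using (IsCommutativeRing)
open import Algebra.Properties.CommutativeSemigroup ℕP.+-commutativeSemigroup
  using () renaming (interchange to +-interchange; x∙yz≈y∙xz to x+[y+z]≡y+[x+z])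
import Tactic.RingSolver.Core.AlmostCommutativeRing as TACR
import Tactic.RingSolver.NonReflective

negG : GI → GI
negG (a +i b) = (- a) +i (- b)

+G-assoc : ∀ x y z → (x +G y) +G z ≡ x +G (y +G z)
+G-assoc (a +i b) (c +i d) (e +i f) = cong₂ _+i_ (ℤP.+-assoc a c e) (ℤP.+-assoc b d f)

+G-comm : ∀ x y → x +G y ≡ y +G x
+G-comm (a +i b) (c +i d) = cong₂ _+i_ (ℤP.+-comm a c) (ℤP.+-comm b d)

+G-identityˡ : ∀ x → 0G +G x ≡ x
+G-identityˡ (a +i b) = cong₂ _+i_ (ℤP.+-identityˡ a) (ℤP.+-identityˡ b)

+G-identityʳ : ∀ x → x +G 0G ≡ x
+G-identityʳ (a +i b) = cong₂ _+i_ (ℤP.+-identityʳ a) (ℤP.+-identityʳ b)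

+G-inverseˡ : ∀ x → negG x +G x ≡ 0G
+G-inverseˡ (a +i b) = cong₂ _+i_ (ℤP.+-inverseˡ a) (ℤP.+-inverseˡ b)

+G-inverseʳ : ∀ x → x +G negG x ≡ 0G
+G-inverseʳ (a +i b) = cong₂ _+i_ (ℤP.+-inverseʳ a) (ℤP.+-inverseʳ b)

*G-assoc : ∀ x y z → (x *G y) *G z ≡ x *G (y *G z)
*G-assoc (a +i b) (c +i d) (e +i f) = cong₂ _+i_ (re-eq a b c d e f) (im-eq a b c d e f)
  where
  re-eq : ∀ a b c d e f → (a * c - b * d) * e - (a * d + b * c) * f ≡ a * (c * e - d * f) - b * (c * f + d * e)
  re-eq = solve-∀
  im-eq : ∀ a b c d e f → (a * c - b * d) * f + (a * d + b * c) * e ≡ a * (c * f + d * e) + b * (c * e - d * f)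
  im-eq = solve-∀

*G-comm : ∀ x y → x *G y ≡ y *G x
*G-comm (a +i b) (c +i d) = cong₂ _+i_ (re-eq a b c d) (im-eq a b c d)
  where
  re-eq : ∀ a b c d → a * c - b * d ≡ c * a - d * b
  re-eq = solve-∀
  im-eq : ∀ a b c d → a * d + b * c ≡ c * b + d * a
  im-eq = solve-∀

*G-distribˡ-+G : ∀ x y z → x *G (y +G z) ≡ (x *G y) +G (x *G z)
*G-distribˡ-+G (a +i b) (c +i d) (e +i f) = cong₂ _+i_ (re-eq a b c d e f) (im-eq a b c d e f)
  where
  re-eq : ∀ a b c d e f → a * (c + e) - b * (d + f) ≡ (a * c - b * d) + (a * e - b * f)
  re-eq = solve-∀
  im-eq : ∀ a b c d e f → a * (d + f) + b * (c + e) ≡ (a * d + b * c) + (a * f + b * e)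
  im-eq = solve-∀

*G-distribʳ-+G : ∀ x y z → (y +G z) *G x ≡ (y *G x) +G (z *G x)
*G-distribʳ-+G x y z = begin
  (y +G z) *G x          ≡⟨ *G-comm (y +G z) x ⟩
  x *G (y +G z)          ≡⟨ *G-distribˡ-+G x y z ⟩
  x *G y +G x *G z       ≡⟨ cong₂ _+G_ (*G-comm x y) (*G-comm x z) ⟩
  y *G x +G z *G x       ∎
  where open ≡-Reasoning

*G-identityˡ : ∀ x → 1G *G x ≡ x
*G-identityˡ (a +i b) = cong₂ _+i_ (re-eq a b) (im-eq a b)
  where
  re-eq : ∀ a b → + 1 * a - + 0 * b ≡ a
  re-eq = solve-∀
  im-eq : ∀ a b → + 1 * b + + 0 * a ≡ b
  im-eq = solve-∀

*G-identityʳ : ∀ x → x *G 1G ≡ x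
*G-identityʳ x = trans (*G-comm x 1G) (*G-identityˡ x)

+G-*G-isCommutativeRing : IsCommutativeRing _≡_ _+G_ _*G_ negG 0G 1G
+G-*G-isCommutativeRing = record
  { isRing = record
    { +-isAbelianGroup = record
      { isGroup = record
        { isMonoid = record
          { isSemigroup = record
            { isMagma = record { isEquivalence = isEquivalence ; ∙-cong = cong₂ _+G_ }
            ; assoc = +G-assoc }
          ; identity = +G-identityˡ , +G-identityʳ }
        ; inverse = +G-inverseˡ , +G-inverseʳ
        ; ⁻¹-cong = cong negG }
      ; comm = +G-comm }
    ; *-cong = cong₂ _*G_
    ; *-assoc = *G-assoc
    ; *-identity = *G-identityˡ , *G-identityʳ
    ; distrib = *G-distribˡ-+G , *G-distribʳ-+G }
  ; *-comm = *G-comm }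

+G-*G-commutativeRing : CommutativeRing _ _
+G-*G-commutativeRing = record { isCommutativeRing = +G-*G-isCommutativeRing }

_≟G_ : (x y : GI) → Dec (x ≡ y)
(a +i b) ≟G (c +i d) with a ℤ.≟ c | b ℤ.≟ d
... | yes refl | yes refl = yes refl
... | no a≢c   | _        = no λ { refl → a≢c refl }
... | yes _    | no b≢d   = no λ { refl → b≢d refl }

module GISolver = Tactic.RingSolver.NonReflective
  (TACR.fromCommutativeRing +G-*G-commutativeRing (λ x → dec⇒maybe (0G ≟G x)))


module _ where
  open GISolver using (solve; _⊕_; _⊗_; ⊝_; _⊜_; Κ)
  abstract
    x≡x-y+y : ∀ x y → x ≡ (x -G y) +G y
    x≡x-y+y = solve 2 (λ x y → x ⊜ ((x ⊕ (⊝ y)) ⊕ y)) refl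
    *G-distribˡ--G : ∀ x y z → x *G (y -G z) ≡ x *G y -G x *G z
    *G-distribˡ--G = solve 3 (λ x y z → (x ⊗ (y ⊕ (⊝ z))) ⊜ ((x ⊗ y) ⊕ (⊝ (x ⊗ z)))) refl
    x-x≡0 : ∀ x → x -G x ≡ 0G
    x-x≡0 = solve 1 (λ x → (x ⊕ (⊝ x)) ⊜ Κ 0G) refl
    *G-zeroˡ : ∀ x → 0G *G x ≡ 0G
    *G-zeroˡ = solve 1 (λ x → (Κ 0G ⊗ x) ⊜ Κ 0G) refl
    *G-zeroʳ : ∀ x → x *G 0G ≡ 0G
    *G-zeroʳ = solve 1 (λ x → (x ⊗ Κ 0G) ⊜ Κ 0G) refl
    negG[x-y]≡y-x : ∀ x y → negG (x -G y) ≡ y -G x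
    negG[x-y]≡y-x = solve 2 (λ x y → (⊝ (x ⊕ (⊝ y))) ⊜ (y ⊕ (⊝ x))) refl
    negG-distribʳ-*G : ∀ x y → negG (x *G y) ≡ x *G negG y
    negG-distribʳ-*G = solve 2 (λ x y → (⊝ (x ⊗ y)) ⊜ (x ⊗ (⊝ y))) refl
    *G-interchange : ∀ w x y z → (w *G x) *G (y *G z) ≡ (w *G y) *G (x *G z)
    *G-interchange = solve 4 (λ w x y z → ((w ⊗ x) ⊗ (y ⊗ z)) ⊜ ((w ⊗ y) ⊗ (x ⊗ z))) refl
    x-[y+z]≡x-y-z : ∀ x y z → x -G (y +G z) ≡ (x -G y) -G z
    x-[y+z]≡x-y-z = solve 3 (λ x y z → (x ⊕ (⊝ (y ⊕ z))) ⊜ ((x ⊕ (⊝ y)) ⊕ (⊝ z))) refl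
    x+y-x≡y : ∀ x y → (x +G y) -G x ≡ y
    x+y-x≡y = solve 2 (λ x y → ((x ⊕ y) ⊕ (⊝ x)) ⊜ y) refl

∥_∥ : GI → ℕ
∥ a +i b ∥ = ℤ.∣ a ∣ ℕ.* ℤ.∣ a ∣ ℕ.+ ℤ.∣ b ∣ ℕ.* ℤ.∣ b ∣

+∥x∥≡norm : ∀ x → + ∥ x ∥ ≡ norm x
+∥x∥≡norm (a +i b) = trans (ℤP.pos-+ (ℤ.∣ a ∣ ℕ.* ℤ.∣ a ∣) _) (cong₂ _+_ (+∣a∣*∣a∣≡a*a a) (+∣a∣*∣a∣≡a*a b))
  where
  +∣a∣*∣a∣≡a*a : ∀ a → + (ℤ.∣ a ∣ ℕ.* ℤ.∣ a ∣) ≡ a * a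
  +∣a∣*∣a∣≡a*a (+ n)    = ℤP.pos-* n n
  +∣a∣*∣a∣≡a*a -[1+ n ] = refl

∥∥-*G : ∀ x y → ∥ x *G y ∥ ≡ ∥ x ∥ ℕ.* ∥ y ∥
∥∥-*G x@(a +i b) y@(c +i d) = ℤP.+-injective (begin
  + ∥ x *G y ∥            ≡⟨ +∥x∥≡norm (x *G y) ⟩
  norm (x *G y)           ≡⟨ norm-*G a b c d ⟩
  norm x * norm y         ≡⟨ sym (cong₂ _*_ (+∥x∥≡norm x) (+∥x∥≡norm y)) ⟩
  + ∥ x ∥ * + ∥ y ∥       ≡⟨ sym (ℤP.pos-* ∥ x ∥ ∥ y ∥) ⟩
  + (∥ x ∥ ℕ.* ∥ y ∥)     ∎)
  where
  open ≡-Reasoning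
  norm-*G : ∀ a b c d → (a * c - b * d) * (a * c - b * d) + (a * d + b * c) * (a * d + b * c)
                        ≡ (a * a + b * b) * (c * c + d * d)
  norm-*G = solve-∀

∥x∥≡0⇒x≡0 : ∀ x → ∥ x ∥ ≡ 0 → x ≡ 0G
∥x∥≡0⇒x≡0 (a +i b) e = cong₂ _+i_ (∣a∣*∣a∣≡0⇒a≡0 a (ℕP.m+n≡0⇒m≡0 _ e)) (∣a∣*∣a∣≡0⇒a≡0 b (ℕP.m+n≡0⇒n≡0 (ℤ.∣ a ∣ ℕ.* ℤ.∣ a ∣) e))
  where
  ∣a∣*∣a∣≡0⇒a≡0 : ∀ a → ℤ.∣ a ∣ ℕ.* ℤ.∣ a ∣ ≡ 0 → a ≡ + 0
  ∣a∣*∣a∣≡0⇒a≡0 (+ zero) _ = refl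

x≢0⇒∥x∥≥1 : ∀ x → ¬ x ≡ 0G → 1 ℕ.≤ ∥ x ∥
x≢0⇒∥x∥≥1 x x≢0 with ∥ x ∥ in eq
... | zero  = ⊥-elim (x≢0 (∥x∥≡0⇒x≡0 x eq))
... | suc _ = s≤s z≤n

x*y≡0⇒x≡0⊎y≡0 : ∀ x y → x *G y ≡ 0G → x ≡ 0G ⊎ y ≡ 0G
x*y≡0⇒x≡0⊎y≡0 x y e with ∥ x ∥ in ex | ∥ y ∥ in ey
... | zero  | _     = inj₁ (∥x∥≡0⇒x≡0 x ex)
... | suc _ | zero  = inj₂ (∥x∥≡0⇒x≡0 y ey)
... | suc m | suc n with trans (sym (trans (∥∥-*G x y) (cong₂ ℕ._*_ ex ey))) (cong ∥_∥ e)
... | ()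

*G-nonzero : ∀ x y → ¬ x ≡ 0G → ¬ y ≡ 0G → ¬ (x *G y) ≡ 0G
*G-nonzero x y x≢0 y≢0 e = [ x≢0 , y≢0 ]′ (x*y≡0⇒x≡0⊎y≡0 x y e)

x-y≡0⇒x≡y : ∀ x y → x -G y ≡ 0G → x ≡ y
x-y≡0⇒x≡y x y e = begin
  x              ≡⟨ x≡x-y+y x y ⟩
  (x -G y) +G y  ≡⟨ cong (_+G y) e ⟩
  0G +G y        ≡⟨ +G-identityˡ y ⟩
  y              ∎
  where open ≡-Reasoning

x≢y⇒x-y≢0 : ∀ {x y} → ¬ x ≡ y → ¬ x -G y ≡ 0G
x≢y⇒x-y≢0 x≢y e = x≢y (x-y≡0⇒x≡y _ _ e)

*G-cancelˡ : ∀ x y z → ¬ x ≡ 0G → x *G y ≡ x *G z → y ≡ z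
*G-cancelˡ x y z x≢0 e with x*y≡0⇒x≡0⊎y≡0 x (y -G z) (trans (*G-distribˡ--G x y z) (trans (cong (_-G (x *G z)) e) (x-x≡0 (x *G z))))
... | inj₁ x≡0 = ⊥-elim (x≢0 x≡0)
... | inj₂ e'  = x-y≡0⇒x≡y y z e'

conj : GI → GI
conj (a +i b) = a +i (- b)

x*conj-x≡∥x∥ : ∀ x → x *G conj x ≡ (+ ∥ x ∥) +i (+ 0)
x*conj-x≡∥x∥ x@(a +i b) = cong₂ _+i_ (trans (re-eq a b) (sym (+∥x∥≡norm x))) (im-eq a b)
  where
  re-eq : ∀ a b → a * a - b * (- b) ≡ a * a + b * b
  re-eq = solve-∀
  im-eq : ∀ a b → a * (- b) + b * a ≡ + 0
  im-eq = solve-∀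

unit⇒∥u∥≡1 : ∀ u → IsUnit u → ∥ u ∥ ≡ 1
unit⇒∥u∥≡1 u (v , e) = ℕP.m*n≡1⇒m≡1 ∥ u ∥ ∥ v ∥ (trans (sym (∥∥-*G u v)) (cong ∥_∥ e))

∥u∥≡1⇒unit : ∀ u → ∥ u ∥ ≡ 1 → IsUnit u
∥u∥≡1⇒unit u e = conj u , trans (x*conj-x≡∥x∥ u) (cong (λ n → (+ n) +i (+ 0)) e)

-- A record rather than Defs' Σ-type _∣G_, so that both sides can be inferred.
infix 4 _∣_
record _∣_ (a b : GI) : Set where
  constructor divides
  field
    quotient : GI
    equality : b ≡ a *G quotient

∣⇒∣G : ∀ {a b} → a ∣ b → a ∣G b
∣⇒∣G (divides q e) = q , e

∣G⇒∣ : ∀ {a b} → a ∣G b → a ∣ b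
∣G⇒∣ (q , e) = divides q e

∣-refl : ∀ a → a ∣ a
∣-refl a = divides 1G (sym (*G-identityʳ a))

∣-trans : ∀ {a b c} → a ∣ b → b ∣ c → a ∣ c
∣-trans {a} (divides x refl) (divides y refl) = divides (x *G y) (*G-assoc a x y)

x∣0 : ∀ a → a ∣ 0G
x∣0 a = divides 0G (sym (*G-zeroʳ a))

1∣x : ∀ a → 1G ∣ a
1∣x a = divides a (sym (*G-identityˡ a))

0∣x⇒x≡0 : ∀ {b} → 0G ∣ b → b ≡ 0G
0∣x⇒x≡0 (divides x refl) = *G-zeroˡ x

x∣x*y : ∀ a b → a ∣ (a *G b)
x∣x*y a b = divides b refl

∣-*ʳ : ∀ {a b} c → a ∣ b → a ∣ (b *G c)
∣-*ʳ {a} c (divides x refl) = divides (x *G c) (*G-assoc a x c)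

∣-*ˡ : ∀ {a b} c → a ∣ b → a ∣ (c *G b)
∣-*ˡ {a} {b} c d = subst (a ∣_) (*G-comm b c) (∣-*ʳ c d)

∣-+ : ∀ {a b c} → a ∣ b → a ∣ c → a ∣ (b +G c)
∣-+ {a} (divides x refl) (divides y refl) = divides (x +G y) (sym (*G-distribˡ-+G a x y))

∣-- : ∀ {a b c} → a ∣ b → a ∣ c → a ∣ (b -G c)
∣-- {a} (divides x refl) (divides y refl) = divides (x -G y) (sym (*G-distribˡ--G a x y))

∣-*G : ∀ {a b c d} → a ∣ b → c ∣ d → (a *G c) ∣ (b *G d)
∣-*G {a} {_} {c} (divides x refl) (divides y refl) = divides (x *G y) (*G-interchange a x c y)

∣-cancelˡ : ∀ a b c → ¬ c ≡ 0G → (c *G a) ∣ (c *G b) → a ∣ b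
∣-cancelˡ a b c c≢0 (divides x e) = divides x (*G-cancelˡ c b (a *G x) c≢0 (trans e (*G-assoc c a x)))

∣-unitʳ : ∀ {a b} u → IsUnit u → a ∣ (b *G u) → a ∣ b
∣-unitʳ {a} {b} u (v , uv≡1) d = subst (a ∣_) buv≡b (∣-*ʳ v d)
  where
  buv≡b : (b *G u) *G v ≡ b
  buv≡b = trans (*G-assoc b u v) (trans (cong (b *G_) uv≡1) (*G-identityʳ b))

∣-unitˡ : ∀ {a b} u → IsUnit u → a ∣ (u *G b) → a ∣ b
∣-unitˡ {a} {b} u u-unit d = ∣-unitʳ u u-unit (subst (a ∣_) (*G-comm u b) d)

unit∣x : ∀ u b → IsUnit u → u ∣ b
unit∣x u b (v , uv≡1) = divides (v *G b) (trans (sym (*G-identityˡ b)) (trans (cong (_*G b) (sym uv≡1)) (*G-assoc u v b)))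

∣⇒∥∥≤ : ∀ {a b} → a ∣ b → ¬ b ≡ 0G → ∥ a ∥ ℕ.≤ ∥ b ∥
∣⇒∥∥≤ {a} {b} (divides x refl) b≢0 = subst (∥ a ∥ ℕ.≤_) (sym (∥∥-*G a x))
  (ℕP.m≤m*n ∥ a ∥ ∥ x ∥ {{ℕ.≢-nonZero (λ e → b≢0 (trans (cong (a *G_) (∥x∥≡0⇒x≡0 x e)) (*G-zeroʳ a)))}})


halve : ∀ M → Σ ℕ λ h → (h ℕ.+ h ≡ M) ⊎ (suc (h ℕ.+ h) ≡ M)
halve zero = 0 , inj₁ refl
halve (suc M) with halve M
... | h , inj₁ e = h , inj₂ (cong suc e)
... | h , inj₂ e = suc h , inj₁ (trans (cong suc (ℕP.+-suc h h)) (cong suc e))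

2∣s-h∣≤M : ∀ s h M → s ℕ.< M → (h ℕ.+ h ≡ M) ⊎ (suc (h ℕ.+ h) ≡ M) → 2 ℕ.* ℤ.∣ + s - + h ∣ ℕ.≤ M
2∣s-h∣≤M s h M s<M M≈2h with ℕP.≤-total h s
... | inj₁ h≤s = subst (λ z → 2 ℕ.* z ℕ.≤ M) (sym ∣s-h∣≡s∸h) (begin
  2 ℕ.* d    ≡⟨ cong (d ℕ.+_) (ℕP.+-identityʳ d) ⟩
  d ℕ.+ d    ≤⟨ ℕP.+-monoʳ-≤ d d≤h ⟩
  d ℕ.+ h    ≡⟨ trans (ℕP.+-comm d h) h+d≡s ⟩
  s          ≤⟨ ℕP.<⇒≤ s<M ⟩
  M          ∎)
  where
  open ℕP.≤-Reasoning
  d = s ℕ.∸ h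
  h+d≡s : h ℕ.+ d ≡ s
  h+d≡s = ℕP.m+[n∸m]≡n h≤s
  ∣s-h∣≡s∸h : ℤ.∣ + s - + h ∣ ≡ d
  ∣s-h∣≡s∸h = trans (cong ℤ.∣_∣ (ℤP.m-n≡m⊖n s h)) (trans (ℤP.∣m⊖n∣≡∣n⊖m∣ s h) (ℤP.∣⊖∣-≤ h≤s))
  M≤2h+1 : M ℕ.≤ suc (h ℕ.+ h)
  M≤2h+1 = [ (λ e → subst (ℕ._≤ suc (h ℕ.+ h)) e (ℕP.n≤1+n _)) , (λ e → ℕP.≤-reflexive (sym e)) ]′ M≈2h
  d≤h : d ℕ.≤ h
  d≤h = ℕP.+-cancelˡ-≤ h d h (ℕP.≤-pred (ℕP.≤-trans (subst (λ z → suc z ℕ.≤ M) (sym h+d≡s) s<M) M≤2h+1))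
... | inj₂ s≤h = subst (λ z → 2 ℕ.* z ℕ.≤ M) (sym ∣s-h∣≡h∸s) (begin
  2 ℕ.* (h ℕ.∸ s)  ≤⟨ ℕP.*-monoʳ-≤ 2 (ℕP.m∸n≤m h s) ⟩
  2 ℕ.* h          ≡⟨ cong (h ℕ.+_) (ℕP.+-identityʳ h) ⟩
  h ℕ.+ h          ≤⟨ [ ℕP.≤-reflexive , (λ e → subst (h ℕ.+ h ℕ.≤_) e (ℕP.n≤1+n _)) ]′ M≈2h ⟩
  M                ∎)
  where
  open ℕP.≤-Reasoning
  ∣s-h∣≡h∸s : ℤ.∣ + s - + h ∣ ≡ h ℕ.∸ s
  ∣s-h∣≡h∸s = trans (cong ℤ.∣_∣ (ℤP.m-n≡m⊖n s h)) (ℤP.∣⊖∣-≤ s≤h)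

round-div : ∀ u M .{{_ : ℕ.NonZero M}} → Σ ℤ λ q → 2 ℕ.* ℤ.∣ u - q * + M ∣ ℕ.≤ M
round-div u M = q , subst (λ z → 2 ℕ.* ℤ.∣ z ∣ ℕ.≤ M) (sym remainder) (2∣s-h∣≤M s h M (ℤD.n%ℕd<d (u + + h) M) (proj₂ (halve M)))
  where
  h = proj₁ (halve M)
  q = (u + + h) ℤ./ℕ M
  s = (u + + h) ℤ.%ℕ M
  remainder : u - q * + M ≡ + s - + h
  remainder = begin
    u - q * + M                       ≡⟨ shift u (+ h) q (+ M) ⟩
    (u + + h) - q * + M - + h         ≡⟨ cong (λ z → z - q * + M - + h) (ℤD.a≡a%ℕn+[a/ℕn]*n (u + + h) M) ⟩
    (+ s + q * + M) - q * + M - + h   ≡⟨ unshift (+ s) q (+ M) (+ h) ⟩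
    + s - + h                         ∎
    where
    open ≡-Reasoning
    shift : ∀ u h q M → u - q * M ≡ (u + h) - q * M - h
    shift = solve-∀
    unshift : ∀ s q M h → (s + q * M) - q * M - h ≡ s - h
    unshift = solve-∀

∥conj∥ : ∀ x → ∥ conj x ∥ ≡ ∥ x ∥
∥conj∥ (a +i b) = cong (λ z → ℤ.∣ a ∣ ℕ.* ℤ.∣ a ∣ ℕ.+ z ℕ.* z) (ℤP.∣-i∣≡∣i∣ b)

-- ℤ[i] is Euclidean: round β ᾱ / N(α) componentwise, so that 4 N(ρ) N(α) ≤ 2 N(α)².
euclidean-div : ∀ β α → ¬ α ≡ 0G → Σ GI λ κ → ∥ β -G α *G κ ∥ ℕ.< ∥ α ∥
euclidean-div β α α≢0 = κ , ∥ρ∥<M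
  where
  M = ∥ α ∥
  instance
    M≢0 : ℕ.NonZero M
    M≢0 = ℕ.≢-nonZero (λ e → α≢0 (∥x∥≡0⇒x≡0 α e))
    2M≢0 : ℕ.NonZero (2 ℕ.* M)
    2M≢0 = ℕP.m*n≢0 2 M
  w = β *G conj α
  R₁ = round-div (re w) M
  R₂ = round-div (im w) M
  κ = proj₁ R₁ +i proj₁ R₂
  ρ = β -G α *G κ
  r₁ = re w - proj₁ R₁ * + M
  r₂ = im w - proj₁ R₂ * + M
  ρᾱ≡r : ρ *G conj α ≡ r₁ +i r₂
  ρᾱ≡r = trans (expand β α κ (conj α)) (trans (cong (λ z → w -G z *G κ) (x*conj-x≡∥x∥ α)) (components (re w) (im w) M (proj₁ R₁) (proj₁ R₂)))
    where
    open GISolver using (solve; _⊕_; _⊗_; ⊝_; _⊜_)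
    expand : ∀ b a k c → (b -G a *G k) *G c ≡ b *G c -G (a *G c) *G k
    expand = solve 4 (λ b a k c → ((b ⊕ (⊝ (a ⊗ k))) ⊗ c) ⊜ ((b ⊗ c) ⊕ (⊝ ((a ⊗ c) ⊗ k)))) refl
    components : ∀ a b M q₁ q₂ → (a +i b) -G (((+ M) +i (+ 0)) *G (q₁ +i q₂)) ≡ (a - q₁ * + M) +i (b - q₂ * + M)
    components a b M q₁ q₂ = cong₂ _+i_ (re-eq a (+ M) q₁ q₂) (im-eq b (+ M) q₁ q₂)
      where
      re-eq : ∀ a M q₁ q₂ → a - (M * q₁ - + 0 * q₂) ≡ a - q₁ * M
      re-eq = solve-∀
      im-eq : ∀ b M q₁ q₂ → b - (M * q₂ + + 0 * q₁) ≡ b - q₂ * M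
      im-eq = solve-∀
  ∥ρ∥*M : ∥ ρ ∥ ℕ.* M ≡ ℤ.∣ r₁ ∣ ℕ.* ℤ.∣ r₁ ∣ ℕ.+ ℤ.∣ r₂ ∣ ℕ.* ℤ.∣ r₂ ∣
  ∥ρ∥*M = trans (cong (∥ ρ ∥ ℕ.*_) (sym (∥conj∥ α))) (trans (sym (∥∥-*G ρ (conj α))) (cong ∥_∥ ρᾱ≡r))
  2∥ρ∥≤M : 2 ℕ.* ∥ ρ ∥ ℕ.≤ M
  2∥ρ∥≤M = ℕP.*-cancelʳ-≤ (2 ℕ.* ∥ ρ ∥) M (2 ℕ.* M) (begin
    (2 ℕ.* ∥ ρ ∥) ℕ.* (2 ℕ.* M)         ≡⟨ scale ∥ ρ ∥ M ⟩
    4 ℕ.* (∥ ρ ∥ ℕ.* M)                 ≡⟨ cong (4 ℕ.*_) ∥ρ∥*M ⟩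
    4 ℕ.* (∣r₁∣ ℕ.* ∣r₁∣ ℕ.+ ∣r₂∣ ℕ.* ∣r₂∣) ≡⟨ squares ∣r₁∣ ∣r₂∣ ⟩
    (2 ℕ.* ∣r₁∣) ℕ.* (2 ℕ.* ∣r₁∣) ℕ.+ (2 ℕ.* ∣r₂∣) ℕ.* (2 ℕ.* ∣r₂∣)
      ≤⟨ ℕP.+-mono-≤ (ℕP.*-mono-≤ (proj₂ R₁) (proj₂ R₁)) (ℕP.*-mono-≤ (proj₂ R₂) (proj₂ R₂)) ⟩
    M ℕ.* M ℕ.+ M ℕ.* M                 ≡⟨ double M ⟩
    M ℕ.* (2 ℕ.* M)                     ∎)
    where
    open ℕP.≤-Reasoning
    ∣r₁∣ = ℤ.∣ r₁ ∣
    ∣r₂∣ = ℤ.∣ r₂ ∣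
    scale : ∀ r M → (2 ℕ.* r) ℕ.* (2 ℕ.* M) ≡ 4 ℕ.* (r ℕ.* M)
    scale = NS.solve-∀
    squares : ∀ x y → 4 ℕ.* (x ℕ.* x ℕ.+ y ℕ.* y) ≡ (2 ℕ.* x) ℕ.* (2 ℕ.* x) ℕ.+ (2 ℕ.* y) ℕ.* (2 ℕ.* y)
    squares = NS.solve-∀
    double : ∀ M → M ℕ.* M ℕ.+ M ℕ.* M ≡ M ℕ.* (2 ℕ.* M)
    double = NS.solve-∀
  ∥ρ∥<M : ∥ ρ ∥ ℕ.< M
  ∥ρ∥<M with ℕP.<-≤-connex ∥ ρ ∥ M
  ... | inj₁ lt  = lt
  ... | inj₂ M≤ρ = ⊥-elim (ℕP.<⇒≱ (ℕ.>-nonZero⁻¹ M) (ℕP.+-cancelˡ-≤ M M 0 (begin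
    M ℕ.+ M              ≤⟨ ℕP.+-mono-≤ M≤ρ M≤ρ ⟩
    ∥ ρ ∥ ℕ.+ ∥ ρ ∥      ≡⟨ cong (∥ ρ ∥ ℕ.+_) (sym (ℕP.+-identityʳ ∥ ρ ∥)) ⟩
    2 ℕ.* ∥ ρ ∥          ≤⟨ 2∥ρ∥≤M ⟩
    M                    ≡⟨ sym (ℕP.+-identityʳ M) ⟩
    M ℕ.+ 0              ∎)))
    where open ℕP.≤-Reasoning

infix 4 _∣?_
_∣?_ : (a b : GI) → Dec (a ∣ b)
a ∣? b with a ≟G 0G
a ∣? b | yes refl with b ≟G 0G
... | yes refl = yes (x∣0 0G)
... | no b≢0   = no (λ d → b≢0 (0∣x⇒x≡0 d))
a ∣? b | no a≢0 with euclidean-div b a a≢0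
... | κ , lt with (b -G a *G κ) ≟G 0G
... | yes e = yes (divides κ (x-y≡0⇒x≡y b (a *G κ) e))
... | no ρ≢0 = no (λ d → ℕP.<⇒≱ lt (∣⇒∥∥≤ (∣-- d (x∣x*y a κ)) ρ≢0))

record Bezout (a b : GI) : Set where
  constructor bezoutWitness
  field
    g x y     : GI
    g≡ax+by   : g ≡ a *G x +G b *G y
    g∣a       : g ∣ a
    g∣b       : g ∣ b

bezout-acc : ∀ n a b → ∥ b ∥ ℕ.< n → Bezout a b
bezout-acc (suc n) a b lt with b ≟G 0G
... | yes refl = bezoutWitness a 1G 0G (a≡a1+00 a) (∣-refl a) (x∣0 a)
  where
  open GISolver using (solve; _⊕_; _⊗_; _⊜_; Κ)
  a≡a1+00 : ∀ a → a ≡ a *G 1G +G 0G *G 0G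
  a≡a1+00 = solve 1 (λ a → a ⊜ ((a ⊗ Κ 1G) ⊕ (Κ 0G ⊗ Κ 0G))) refl
... | no b≢0 with euclidean-div a b b≢0
... | κ , lt' with bezout-acc n b (a -G b *G κ) (ℕP.<-≤-trans lt' (ℕP.≤-pred lt))
... | bezoutWitness g x y e g∣b g∣ρ =
  bezoutWitness g y (x -G κ *G y) (trans e (regroup a b κ x y))
    (subst (g ∣_) (sym (x≡x-y+y a (b *G κ))) (∣-+ g∣ρ (∣-*ʳ κ g∣b))) g∣b
  where
  open GISolver using (solve; _⊕_; _⊗_; ⊝_; _⊜_)
  regroup : ∀ a b κ x y → b *G x +G (a -G b *G κ) *G y ≡ a *G y +G b *G (x -G κ *G y)
  regroup = solve 5 (λ a b κ x y → ((b ⊗ x) ⊕ ((a ⊕ (⊝ (b ⊗ κ))) ⊗ y)) ⊜ ((a ⊗ y) ⊕ (b ⊗ (x ⊕ (⊝ (κ ⊗ y)))))) refl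

bezout : ∀ a b → Bezout a b
bezout a b = bezout-acc (suc ∥ b ∥) a b (ℕP.n<1+n _)

prime-nonzero : ∀ {p} → IsPrime p → ¬ p ≡ 0G
prime-nonzero (p≢0 , _ , _) = p≢0

prime-nonunit : ∀ {p} → IsPrime p → ¬ IsUnit p
prime-nonunit (_ , nonunit , _) = nonunit

prime-irreducible : ∀ {p} → IsPrime p → ∀ a b → p ≡ a *G b → IsUnit a ⊎ IsUnit b
prime-irreducible (_ , _ , irreducible) = irreducible

-- A gcd g of p and a is p up to a unit (then p ∣ a) or a unit (then p ∣ b, by Bézout).
euclidsLemma : ∀ {p} → IsPrime p → ∀ a b → p ∣ a *G b → p ∣ a ⊎ p ∣ b
euclidsLemma {p} p-prime a b p∣ab with p ∣? a
... | yes p∣a = inj₁ p∣a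
... | no p∤a with bezout p a
... | bezoutWitness g x y g≡px+ay (divides w p≡gw) g∣a with prime-irreducible p-prime g w p≡gw
... | inj₂ (v , wv≡1) = ⊥-elim (p∤a (∣-trans p∣g g∣a))
  where
  p∣g : p ∣ g
  p∣g = divides v (trans (sym (*G-identityʳ g)) (trans (cong (g *G_) (sym wv≡1)) (trans (sym (*G-assoc g w v)) (cong (_*G v) (sym p≡gw)))))
... | inj₁ (v , gv≡1) = inj₂ (subst (p ∣_) gvb≡b (subst (λ z → p ∣ (z *G v) *G b) (sym g≡px+ay)
        (subst (p ∣_) (sym (expand p x a y v b)) (∣-+ (x∣x*y p _) (∣-*ʳ (y *G v) p∣ab)))))
  where
  open GISolver using (solve; _⊕_; _⊗_; _⊜_)
  expand : ∀ p x a y v b → ((p *G x +G a *G y) *G v) *G b ≡ p *G (x *G v *G b) +G (a *G b) *G (y *G v)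
  expand = solve 6 (λ p x a y v b → (((p ⊗ x) ⊕ (a ⊗ y)) ⊗ v) ⊗ b ⊜ ((p ⊗ ((x ⊗ v) ⊗ b)) ⊕ ((a ⊗ b) ⊗ (y ⊗ v)))) refl
  gvb≡b : (g *G v) *G b ≡ b
  gvb≡b = trans (cong (_*G b) gv≡1) (*G-identityˡ b)


any?-ℤ-bounded : ∀ N (P : ℤ → Set) → (∀ z → Dec (P z)) → Dec (Σ ℤ λ z → ℤ.∣ z ∣ ℕ.≤ N × P z)
any?-ℤ-bounded zero P P? with P? (+ 0)
... | yes p = yes (+ 0 , z≤n , p)
... | no ¬p = no λ { (+ zero , _ , p) → ¬p p ; (+ suc n , () , _) ; (-[1+ n ] , () , _) }
any?-ℤ-bounded (suc N) P P? with P? (+ suc N) | P? -[1+ N ] | any?-ℤ-bounded N P P?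
... | yes p | _     | _               = yes (+ suc N , ℕP.≤-refl , p)
... | no _  | yes p | _               = yes (-[1+ N ] , ℕP.≤-refl , p)
... | no _  | no _  | yes (z , ≤N , p) = yes (z , ℕP.m≤n⇒m≤1+n ≤N , p)
... | no ¬p₊ | no ¬p₋ | no ¬p≤N = no none
  where
  none : ¬ (Σ ℤ λ z → ℤ.∣ z ∣ ℕ.≤ suc N × P z)
  none (z , ≤1+N , p) with ℕP.m≤n⇒m<n∨m≡n ≤1+N
  ... | inj₁ <1+N = ¬p≤N (z , ℕP.≤-pred <1+N , p)
  none (+ .(suc N) , _ , p) | inj₂ refl = ¬p₊ p
  none (-[1+ .N ] , _ , p)  | inj₂ refl = ¬p₋ p

any?-GI-bounded : ∀ N (P : GI → Set) → (∀ z → Dec (P z)) → Dec (Σ GI λ d → ℤ.∣ re d ∣ ℕ.≤ N × ℤ.∣ im d ∣ ℕ.≤ N × P d)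
any?-GI-bounded N P P? with any?-ℤ-bounded N (λ a → Σ ℤ λ b → ℤ.∣ b ∣ ℕ.≤ N × P (a +i b)) (λ a → any?-ℤ-bounded N (λ b → P (a +i b)) (λ b → P? (a +i b)))
... | yes (a , a≤N , b , b≤N , p) = yes (a +i b , a≤N , b≤N , p)
... | no ¬p = no λ { ((a +i b) , a≤N , b≤N , p) → ¬p (a , a≤N , b , b≤N , p) }

n≤n*n : ∀ n → n ℕ.≤ n ℕ.* n
n≤n*n zero    = z≤n
n≤n*n (suc n) = ℕP.m≤m*n (suc n) (suc n)

∣re∣≤∥∥ : ∀ x → ℤ.∣ re x ∣ ℕ.≤ ∥ x ∥
∣re∣≤∥∥ (a +i b) = ℕP.≤-trans (n≤n*n ℤ.∣ a ∣) (ℕP.m≤m+n _ _)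

∣im∣≤∥∥ : ∀ x → ℤ.∣ im x ∣ ℕ.≤ ∥ x ∥
∣im∣≤∥∥ (a +i b) = ℕP.≤-trans (n≤n*n ℤ.∣ b ∣) (ℕP.m≤n+m _ _)

IsUnit? : ∀ u → Dec (IsUnit u)
IsUnit? u with ∥ u ∥ ℕ.≟ 1
... | yes e  = yes (∥u∥≡1⇒unit u e)
... | no ∥u∥≢1 = no (λ u-unit → ∥u∥≢1 (unit⇒∥u∥≡1 u u-unit))

nonunit⇒∥∥≥2 : ∀ x → ¬ x ≡ 0G → ¬ IsUnit x → 2 ℕ.≤ ∥ x ∥
nonunit⇒∥∥≥2 x x≢0 nonunit with ∥ x ∥ in e
... | zero        = ⊥-elim (x≢0 (∥x∥≡0⇒x≡0 x e))
... | suc zero    = ⊥-elim (nonunit (∥u∥≡1⇒unit x e))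
... | suc (suc k) = s≤s (s≤s z≤n)

ProperDivisor : GI → GI → Set
ProperDivisor a d = d ∣ a × 1 ℕ.< ∥ d ∥ × ∥ d ∥ ℕ.< ∥ a ∥

ProperDivisor? : ∀ a d → Dec (ProperDivisor a d)
ProperDivisor? a d with d ∣? a | 1 ℕ.<? ∥ d ∥ | ∥ d ∥ ℕ.<? ∥ a ∥
... | yes x | yes y | yes z = yes (x , y , z)
... | no ¬x | _     | _     = no (λ t → ¬x (proj₁ t))
... | yes _ | no ¬y | _     = no (λ t → ¬y (proj₁ (proj₂ t)))
... | yes _ | yes _ | no ¬z = no (λ t → ¬z (proj₂ (proj₂ t)))

-- A nonzero nonunit without a proper divisor (found by bounded search) is itself prime.
prime-divisor : ∀ n a → ∥ a ∥ ℕ.< n → ¬ a ≡ 0G → ¬ IsUnit a → Σ GI λ p → IsPrime p × p ∣ a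
prime-divisor (suc n) a lt a≢0 nonunit with any?-GI-bounded ∥ a ∥ (ProperDivisor a) (ProperDivisor? a)
... | yes (d , _ , _ , d∣a , 1<d , d<a) =
  let (p , p-prime , p∣d) = prime-divisor n d (ℕP.<-≤-trans d<a (ℕP.≤-pred lt)) d≢0 d-nonunit
  in p , p-prime , ∣-trans p∣d d∣a
  where
  d≢0 : ¬ d ≡ 0G
  d≢0 e = ℕP.<-irrefl (sym (cong ∥_∥ e)) (ℕP.<-trans (s≤s z≤n) 1<d)
  d-nonunit : ¬ IsUnit d
  d-nonunit d-unit = ℕP.<-irrefl (sym (unit⇒∥u∥≡1 d d-unit)) 1<d
... | no no-proper = a , (a≢0 , nonunit , irreducible) , ∣-refl a
  where
  irreducible : ∀ x y → a ≡ x *G y → IsUnit x ⊎ IsUnit y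
  irreducible x y a≡xy with IsUnit? x | IsUnit? y
  ... | yes x-unit | _          = inj₁ x-unit
  ... | no _       | yes y-unit = inj₂ y-unit
  ... | no x-nonunit | no y-nonunit =
    ⊥-elim (no-proper (x , ℕP.≤-trans (∣re∣≤∥∥ x) x≤a , ℕP.≤-trans (∣im∣≤∥∥ x) x≤a , divides y a≡xy , 2≤x , x<a))
    where
    x≢0 : ¬ x ≡ 0G
    x≢0 x≡0 = a≢0 (trans a≡xy (trans (cong (_*G y) x≡0) (*G-zeroˡ y)))
    y≢0 : ¬ y ≡ 0G
    y≢0 y≡0 = a≢0 (trans a≡xy (trans (cong (x *G_) y≡0) (*G-zeroʳ x)))
    2≤x = nonunit⇒∥∥≥2 x x≢0 x-nonunit
    x<a : ∥ x ∥ ℕ.< ∥ a ∥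
    x<a = subst (∥ x ∥ ℕ.<_) (sym (trans (cong ∥_∥ a≡xy) (∥∥-*G x y)))
            (ℕP.m<m*n ∥ x ∥ ∥ y ∥ {{ℕ.>-nonZero (ℕP.<-trans (s≤s z≤n) 2≤x)}} (nonunit⇒∥∥≥2 y y≢0 y-nonunit))
    x≤a : ∥ x ∥ ℕ.≤ ∥ a ∥
    x≤a = ℕP.<⇒≤ x<a

^G-nonzero : ∀ p e → ¬ p ≡ 0G → ¬ (p ^G e) ≡ 0G
^G-nonzero p zero    p≢0 ()
^G-nonzero p (suc e) p≢0 = *G-nonzero p (p ^G e) p≢0 (^G-nonzero p e p≢0)

x^1≡x : ∀ p → (p ^G 1) ≡ p
x^1≡x p = *G-identityʳ p

coprime-^G-∣ : ∀ {q} → IsPrime q → ∀ p → ¬ q ∣ p → ∀ e c → (q ^G e) ∣ p *G c → (q ^G e) ∣ c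
coprime-^G-∣ q-prime p q∤p zero c _ = 1∣x c
coprime-^G-∣ {q} q-prime p q∤p (suc e) c d with euclidsLemma q-prime p c (∣-trans (x∣x*y q (q ^G e)) d)
... | inj₁ q∣p = ⊥-elim (q∤p q∣p)
... | inj₂ (divides c' refl) = ∣-*G (∣-refl q) (coprime-^G-∣ q-prime p q∤p e c'
        (∣-cancelˡ (q ^G e) (p *G c') q (prime-nonzero q-prime) (subst ((q ^G suc e) ∣_) (swap p q c') d)))
  where
  swap : ∀ p q c → p *G (q *G c) ≡ q *G (p *G c)
  swap p q c = trans (sym (*G-assoc p q c)) (trans (cong (_*G c) (*G-comm p q)) (*G-assoc q p c))

-- Peel off a prime factor p of a; primes associate to p contribute one extra power of p to b.
prime-powers⇒∣-acc : ∀ n a b → ∥ a ∥ ℕ.< n → ¬ a ≡ 0G → (∀ p → IsPrime p → ∀ e → (p ^G e) ∣ a → (p ^G e) ∣ b) → a ∣ b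
prime-powers⇒∣-acc (suc n) a b lt a≢0 powers with IsUnit? a
... | yes a-unit = unit∣x a b a-unit
... | no nonunit with prime-divisor (suc ∥ a ∥) a (ℕP.n<1+n _) a≢0 nonunit
... | p , p-prime , divides a' refl with subst (_∣ b) (x^1≡x p) (powers p p-prime 1 (subst (_∣ p *G a') (sym (x^1≡x p)) (x∣x*y p a')))
... | divides b' refl = ∣-*G (∣-refl p) (prime-powers⇒∣-acc n a' b' ∥a'∥<n a'≢0 powers')
  where
  a'≢0 : ¬ a' ≡ 0G
  a'≢0 e = a≢0 (trans (cong (p *G_) e) (*G-zeroʳ p))
  ∥a'∥<n : ∥ a' ∥ ℕ.< n
  ∥a'∥<n = ℕP.<-≤-trans (subst (∥ a' ∥ ℕ.<_) (sym (trans (∥∥-*G p a') (ℕP.*-comm ∥ p ∥ ∥ a' ∥)))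
             (ℕP.m<m*n ∥ a' ∥ ∥ p ∥ {{ℕ.>-nonZero (x≢0⇒∥x∥≥1 a' a'≢0)}} (nonunit⇒∥∥≥2 p (prime-nonzero p-prime) (prime-nonunit p-prime))))
             (ℕP.≤-pred lt)
  powers' : ∀ q → IsPrime q → ∀ e → (q ^G e) ∣ a' → (q ^G e) ∣ b'
  powers' q q-prime e d with q ∣? p
  ... | no q∤p = coprime-^G-∣ q-prime p q∤p e b' (powers q q-prime e (∣-*ˡ p d))
  ... | yes (divides w p≡qw) with prime-irreducible p-prime q w p≡qw
  ... | inj₁ q-unit = ⊥-elim (prime-nonunit q-prime q-unit)
  ... | inj₂ w-unit = ∣-unitˡ w w-unit (∣-cancelˡ (q ^G e) (w *G b') q (prime-nonzero q-prime)
          (subst ((q ^G suc e) ∣_) (pc≡qwc b') (powers q q-prime (suc e) (subst ((q ^G suc e) ∣_) (sym (pc≡qwc a')) (∣-*G (∣-refl q) (∣-*ˡ w d))))))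
    where
    pc≡qwc : ∀ c → p *G c ≡ q *G (w *G c)
    pc≡qwc c = trans (cong (_*G c) p≡qw) (*G-assoc q w c)

prime-powers⇒∣ : ∀ a b → ¬ a ≡ 0G → (∀ p → IsPrime p → ∀ e → (p ^G e) ∣ a → (p ^G e) ∣ b) → a ∣ b
prime-powers⇒∣ a b = prime-powers⇒∣-acc (suc ∥ a ∥) a b (ℕP.n<1+n _)


indicator : ∀ {P : Set} → Dec P → ℕ
indicator (yes _) = 1
indicator (no _) = 0

indicator-cong : ∀ {P Q : Set} (p : Dec P) (q : Dec Q) → (P → Q) → (Q → P) → indicator p ≡ indicator q
indicator-cong (yes _) (yes _) f g = refl
indicator-cong (yes x) (no y) f g = ⊥-elim (y (f x))
indicator-cong (no x) (yes y) f g = ⊥-elim (x (g y))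
indicator-cong (no _) (no _) f g = refl

indicator-yes : ∀ {P : Set} (p : Dec P) → P → indicator p ≡ 1
indicator-yes (yes _) _ = refl
indicator-yes (no n) x = ⊥-elim (n x)

indicator-no : ∀ {P : Set} (p : Dec P) → ¬ P → indicator p ≡ 0
indicator-no (yes x) n = ⊥-elim (n x)
indicator-no (no _) _ = refl

sumFin : ∀ {m} → (Fin m → ℕ) → ℕ
sumFin {zero} f = 0
sumFin {suc m} f = f zero ℕ.+ sumFin (λ i → f (suc i))

sumFin-cong : ∀ {m} {f g : Fin m → ℕ} → (∀ i → f i ≡ g i) → sumFin f ≡ sumFin g
sumFin-cong {zero} h = refl
sumFin-cong {suc m} h = cong₂ ℕ._+_ (h zero) (sumFin-cong (λ i → h (suc i)))

sumFin-mono-≤ : ∀ {m} {f g : Fin m → ℕ} → (∀ i → f i ℕ.≤ g i) → sumFin f ℕ.≤ sumFin g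
sumFin-mono-≤ {zero} h = z≤n
sumFin-mono-≤ {suc m} h = ℕP.+-mono-≤ (h zero) (sumFin-mono-≤ (λ i → h (suc i)))

sumFin-+ : ∀ {m} (f g : Fin m → ℕ) → sumFin (λ i → f i ℕ.+ g i) ≡ sumFin f ℕ.+ sumFin g
sumFin-+ {zero} f g = refl
sumFin-+ {suc m} f g = trans (cong (f zero ℕ.+ g zero ℕ.+_) (sumFin-+ (λ i → f (suc i)) (λ i → g (suc i)))) (+-interchange (f zero) (g zero) (sumFin (λ i → f (suc i))) (sumFin (λ i → g (suc i))))

sumFin-0 : ∀ m → sumFin {m} (λ _ → 0) ≡ 0
sumFin-0 zero = refl
sumFin-0 (suc m) = sumFin-0 m

sumFin-1 : ∀ m → sumFin {m} (λ _ → 1) ≡ m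
sumFin-1 zero = refl
sumFin-1 (suc m) = cong suc (sumFin-1 m)

sumFin-term : ∀ {m} (f : Fin m → ℕ) i → f i ℕ.≤ sumFin f
sumFin-term f zero = ℕP.m≤m+n _ _
sumFin-term f (suc i) = ℕP.≤-trans (sumFin-term (λ i → f (suc i)) i) (ℕP.m≤n+m _ _)

sumFin-indicator≥1⇒∃ : ∀ {m} (P : Fin m → Set) (P? : ∀ i → Dec (P i)) → 1 ℕ.≤ sumFin (λ i → indicator (P? i)) → Σ (Fin m) P
sumFin-indicator≥1⇒∃ {zero} P P? ()
sumFin-indicator≥1⇒∃ {suc m} P P? le with P? zero
... | yes pz = zero , pz
... | no _ with sumFin-indicator≥1⇒∃ (λ i → P (suc i)) (λ i → P? (suc i)) le
... | i , pi = suc i , pi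

sumFin-indicator≤0⇒∄ : ∀ {m} (P : Fin m → Set) (P? : ∀ i → Dec (P i)) → sumFin (λ i → indicator (P? i)) ℕ.≤ 0 → ∀ i → ¬ P i
sumFin-indicator≤0⇒∄ P P? le i pi = ℕP.<-irrefl refl (ℕP.≤-trans (subst (ℕ._≤ sumFin (λ i → indicator (P? i))) (indicator-yes (P? i) pi) (sumFin-term (λ i → indicator (P? i)) i)) le)

sumFin-punchIn : ∀ {n} (j : Fin (suc n)) (f : Fin (suc n) → ℕ) → sumFin f ≡ f j ℕ.+ sumFin (λ i → f (punchIn j i))
sumFin-punchIn zero f = refl
sumFin-punchIn {zero} (suc ()) f
sumFin-punchIn {suc n} (suc j) f = trans (cong (f zero ℕ.+_) (sumFin-punchIn j (λ i → f (suc i)))) (x+[y+z]≡y+[x+z] (f zero) (f (suc j)) _)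

sumLevels : ℕ → (ℕ → ℕ) → ℕ
sumLevels zero f = 0
sumLevels (suc L) f = f (suc L) ℕ.+ sumLevels L f

sumLevels-cong : ∀ L {f g : ℕ → ℕ} → (∀ l → f l ≡ g l) → sumLevels L f ≡ sumLevels L g
sumLevels-cong zero h = refl
sumLevels-cong (suc L) h = cong₂ ℕ._+_ (h (suc L)) (sumLevels-cong L h)

sumLevels-+ : ∀ L (f g : ℕ → ℕ) → sumLevels L (λ l → f l ℕ.+ g l) ≡ sumLevels L f ℕ.+ sumLevels L g
sumLevels-+ zero f g = refl
sumLevels-+ (suc L) f g = trans (cong (f (suc L) ℕ.+ g (suc L) ℕ.+_) (sumLevels-+ L f g)) (+-interchange (f (suc L)) (g (suc L)) _ _)

sumLevels-0 : ∀ L → sumLevels L (λ _ → 0) ≡ 0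
sumLevels-0 zero = refl
sumLevels-0 (suc L) = sumLevels-0 L

sumLevels-mono-≤ : ∀ L {f g : ℕ → ℕ} → (∀ l → f l ℕ.≤ g l) → sumLevels L f ℕ.≤ sumLevels L g
sumLevels-mono-≤ zero h = z≤n
sumLevels-mono-≤ (suc L) h = ℕP.+-mono-≤ (h (suc L)) (sumLevels-mono-≤ L h)

sumLevels-mono-≤' : ∀ L {f g : ℕ → ℕ} → (∀ l → 1 ℕ.≤ l → l ℕ.≤ L → f l ℕ.≤ g l) → sumLevels L f ℕ.≤ sumLevels L g
sumLevels-mono-≤' zero h = z≤n
sumLevels-mono-≤' (suc L) h = ℕP.+-mono-≤ (h (suc L) (s≤s z≤n) ℕP.≤-refl) (sumLevels-mono-≤' L (λ l a b → h l a (ℕP.m≤n⇒m≤1+n b)))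

sumLevels-mono-< : ∀ L {f g : ℕ → ℕ} → (∀ h → 1 ℕ.≤ h → h ℕ.≤ L → f h ℕ.≤ g h) → ∀ h0 → 1 ℕ.≤ h0 → h0 ℕ.≤ L → suc (f h0) ℕ.≤ g h0 → suc (sumLevels L f) ℕ.≤ sumLevels L g
sumLevels-mono-< zero h h0 a b c = ⊥-elim (ℕP.<-irrefl refl (ℕP.≤-trans a b))
sumLevels-mono-< (suc L) {f} {g} h h0 a b c with ℕP.m≤n⇒m<n∨m≡n b
... | inj₂ refl = ℕP.+-mono-≤ c (sumLevels-mono-≤' L (λ l x y → h l x (ℕP.m≤n⇒m≤1+n y)))
... | inj₁ lt = subst (ℕ._≤ sumLevels (suc L) g) (ℕP.+-suc (f (suc L)) (sumLevels L f)) (ℕP.+-mono-≤ (h (suc L) (s≤s z≤n) ℕP.≤-refl) (sumLevels-mono-< L (λ l x y → h l x (ℕP.m≤n⇒m≤1+n y)) h0 a (ℕP.≤-pred lt) c))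

sumLevels-≡⇒≡ : ∀ L {f g : ℕ → ℕ} → (∀ l → 1 ℕ.≤ l → l ℕ.≤ L → f l ℕ.≤ g l) → sumLevels L f ≡ sumLevels L g → ∀ l → 1 ℕ.≤ l → l ℕ.≤ L → f l ≡ g l
sumLevels-≡⇒≡ L {f} {g} h e l a b = ℕP.≤-antisym (h l a b) (d (g l ℕ.≤? f l))
  where
  d : Dec (g l ℕ.≤ f l) → g l ℕ.≤ f l
  d (yes q) = q
  d (no nq) = ⊥-elim (ℕP.<-irrefl e (sumLevels-mono-< L h l a b (ℕP.≰⇒> nq)))

sumFin-sumLevels-comm : ∀ {m} L (f : Fin m → ℕ → ℕ) → sumFin (λ i → sumLevels L (f i)) ≡ sumLevels L (λ l → sumFin (λ i → f i l))
sumFin-sumLevels-comm {zero} L f = sym (sumLevels-0 L)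
sumFin-sumLevels-comm {suc m} L f = trans (cong (sumLevels L (f zero) ℕ.+_) (sumFin-sumLevels-comm L (λ i → f (suc i)))) (sym (sumLevels-+ L (f zero) (λ l → sumFin (λ i → f (suc i) l))))

sumList : ∀ {A : Set} → List A → (A → ℕ) → ℕ
sumList [] f = 0
sumList (t ∷ ts) f = f t ℕ.+ sumList ts f

sumList-cong : ∀ {A : Set} (R : List A) {f g : A → ℕ} → (∀ t → t ∈ R → f t ≡ g t) → sumList R f ≡ sumList R g
sumList-cong [] h = refl
sumList-cong (t ∷ R) h = cong₂ ℕ._+_ (h t (here refl)) (sumList-cong R (λ t' m → h t' (there m)))

sumList-0 : ∀ {A : Set} (R : List A) (f : A → ℕ) → (∀ t → t ∈ R → f t ≡ 0) → sumList R f ≡ 0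
sumList-0 [] f h = refl
sumList-0 (t ∷ R) f h = cong₂ ℕ._+_ (h t (here refl)) (sumList-0 R f (λ t' m → h t' (there m)))

sumList≡0⇒ : ∀ {A : Set} (R : List A) (f : A → ℕ) → sumList R f ≡ 0 → ∀ t → t ∈ R → f t ≡ 0
sumList≡0⇒ (u ∷ R) f e .u (here refl) = ℕP.m+n≡0⇒m≡0 (f u) e
sumList≡0⇒ (u ∷ R) f e t (there m) = sumList≡0⇒ R f (ℕP.m+n≡0⇒n≡0 (f u) e) t m

sumList-mono-≤ : ∀ {A : Set} (R : List A) {f g : A → ℕ} → (∀ t → t ∈ R → f t ℕ.≤ g t) → sumList R f ℕ.≤ sumList R g
sumList-mono-≤ [] h = z≤n
sumList-mono-≤ (t ∷ R) h = ℕP.+-mono-≤ (h t (here refl)) (sumList-mono-≤ R (λ t' m → h t' (there m)))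

sumList-mono-≤-+2 : ∀ {A : Set} (R : List A) {f g : A → ℕ} {t₀} → t₀ ∈ R → (∀ t → t ∈ R → f t ℕ.≤ g t) → 2 ℕ.+ f t₀ ℕ.≤ g t₀ → 2 ℕ.+ sumList R f ℕ.≤ sumList R g
sumList-mono-≤-+2 (t ∷ R) (here refl) h h2 = ℕP.+-mono-≤ h2 (sumList-mono-≤ R (λ t' m → h t' (there m)))
sumList-mono-≤-+2 (t ∷ R) {f} {g} (there m) h h2 = subst (ℕ._≤ sumList (t ∷ R) g) (sym (x+[y+z]≡y+[x+z] 2 (f t) (sumList R f))) (ℕP.+-mono-≤ (h t (here refl)) (sumList-mono-≤-+2 R m (λ t' m' → h t' (there m')) h2))

sumList-+ : ∀ {A : Set} (R : List A) (f g : A → ℕ) → sumList R (λ t → f t ℕ.+ g t) ≡ sumList R f ℕ.+ sumList R g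
sumList-+ [] f g = refl
sumList-+ (t ∷ R) f g = trans (cong (f t ℕ.+ g t ℕ.+_) (sumList-+ R f g)) (+-interchange (f t) (g t) _ _)

sumList-*ʳ : ∀ {A : Set} (R : List A) (f : A → ℕ) c → sumList R (λ t → f t ℕ.* c) ≡ sumList R f ℕ.* c
sumList-*ʳ [] f c = refl
sumList-*ʳ (t ∷ R) f c = trans (cong (f t ℕ.* c ℕ.+_) (sumList-*ʳ R f c)) (sym (ℕP.*-distribʳ-+ c (f t) (sumList R f)))

sumList-sumFin-comm : ∀ {A : Set} (R : List A) {k} (f : A → Fin k → ℕ) → sumList R (λ t → sumFin (f t)) ≡ sumFin (λ i → sumList R (λ t → f t i))
sumList-sumFin-comm [] {k} f = sym (sumFin-0 k)
sumList-sumFin-comm (t ∷ R) f = trans (cong (sumFin (f t) ℕ.+_) (sumList-sumFin-comm R f)) (sym (sumFin-+ (f t) (λ i → sumList R (λ t' → f t' i))))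


argmax : ∀ {A : Set} (R : List A) (f : A → ℕ) {x} → x ∈ R → Σ A λ t → t ∈ R × (∀ t' → t' ∈ R → f t' ℕ.≤ f t)
argmax (t ∷ []) f (here refl) = t , here refl , λ { t' (here refl) → ℕP.≤-refl ; t' (there ()) }
argmax (t ∷ u ∷ R) f _ with argmax (u ∷ R) f (here refl)
... | m , m∈ , m-max with f t ℕ.≤? f m
... | yes ft≤fm = m , there m∈ , λ { t' (here refl) → ft≤fm ; t' (there t'∈) → m-max t' t'∈ }
... | no ft≰fm  = t , here refl , λ { t' (here refl) → ℕP.≤-refl ; t' (there t'∈) → ℕP.≤-trans (m-max t' t'∈) (ℕP.<⇒≤ (ℕP.≰⇒> ft≰fm)) }

argmin : ∀ {A : Set} (R : List A) (f : A → ℕ) {x} → x ∈ R → Σ A λ t → t ∈ R × (∀ t' → t' ∈ R → f t ℕ.≤ f t')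
argmin (t ∷ []) f (here refl) = t , here refl , λ { t' (here refl) → ℕP.≤-refl ; t' (there ()) }
argmin (t ∷ u ∷ R) f _ with argmin (u ∷ R) f (here refl)
... | m , m∈ , m-min with f m ℕ.≤? f t
... | yes fm≤ft = m , there m∈ , λ { t' (here refl) → fm≤ft ; t' (there t'∈) → m-min t' t'∈ }
... | no fm≰ft  = t , here refl , λ { t' (here refl) → ℕP.≤-refl ; t' (there t'∈) → ℕP.≤-trans (ℕP.<⇒≤ (ℕP.≰⇒> fm≰ft)) (m-min t' t'∈) }

-- p-adic valuations

ExactPower : GI → ℕ → GI → Set
ExactPower p e y = (p ^G e) ∣ y × ¬ (p ^G suc e) ∣ y

^G-+ : ∀ p a b → p ^G (a ℕ.+ b) ≡ (p ^G a) *G (p ^G b)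
^G-+ p zero    b = sym (*G-identityˡ _)
^G-+ p (suc a) b = trans (cong (p *G_) (^G-+ p a b)) (sym (*G-assoc p _ _))

^G-sucʳ : ∀ p e → p ^G suc e ≡ (p ^G e) *G p
^G-sucʳ p e = trans (cong (p ^G_) (ℕP.+-comm 1 e)) (trans (^G-+ p e 1) (cong ((p ^G e) *G_) (x^1≡x p)))

^G-mono-∣ : ∀ p {a b} → a ℕ.≤ b → (p ^G a) ∣ (p ^G b)
^G-mono-∣ p {a} {b} a≤b = divides (p ^G (b ℕ.∸ a)) (trans (cong (p ^G_) (sym (ℕP.m+[n∸m]≡n a≤b))) (^G-+ p a (b ℕ.∸ a)))

∥∥-^G : ∀ q e → ∥ q ^G e ∥ ≡ ∥ q ∥ ℕ.^ e
∥∥-^G q zero    = refl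
∥∥-^G q (suc e) = trans (∥∥-*G q (q ^G e)) (cong (∥ q ∥ ℕ.*_) (∥∥-^G q e))

n<2^n : ∀ n → n ℕ.< 2 ℕ.^ n
n<2^n zero    = s≤s z≤n
n<2^n (suc n) = begin
  suc (suc n)          ≡⟨ cong suc (ℕP.+-comm 1 n) ⟩
  suc n ℕ.+ 1          ≤⟨ ℕP.+-mono-≤ (n<2^n n) (ℕP.m^n>0 2 n) ⟩
  2 ℕ.^ n ℕ.+ 2 ℕ.^ n  ≡⟨ cong (2 ℕ.^ n ℕ.+_) (sym (ℕP.+-identityʳ _)) ⟩
  2 ℕ.^ suc n          ∎
  where open ℕP.≤-Reasoning

-- Since ∥p∥ ≥ 2, the norm of y bounds every exponent e with p^e ∣ y.
^G-∤ : ∀ {p} → IsPrime p → ∀ y → ¬ y ≡ 0G → ∀ L → ∥ y ∥ ℕ.≤ L → ¬ (p ^G L) ∣ y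
^G-∤ {p} p-prime y y≢0 L ∥y∥≤L p^L∣y = ℕP.<-irrefl refl (begin-strict
  L                  <⟨ n<2^n L ⟩
  2 ℕ.^ L            ≤⟨ ℕP.^-monoˡ-≤ L (nonunit⇒∥∥≥2 p (prime-nonzero p-prime) (prime-nonunit p-prime)) ⟩
  ∥ p ∥ ℕ.^ L        ≡⟨ sym (∥∥-^G p L) ⟩
  ∥ p ^G L ∥         ≤⟨ ∣⇒∥∥≤ p^L∣y y≢0 ⟩
  ∥ y ∥              ≤⟨ ∥y∥≤L ⟩
  L                  ∎)
  where open ℕP.≤-Reasoning

exactPower-unique : ∀ {p e e' y} → ExactPower p e y → ExactPower p e' y → e ≡ e'
exactPower-unique {p} {e} {e'} (d , ¬d) (d' , ¬d') with ℕP.<-cmp e e'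
... | tri≈ _ e≡e' _ = e≡e'
... | tri< e<e' _ _ = ⊥-elim (¬d (∣-trans (^G-mono-∣ p e<e') d'))
... | tri> _ _ e>e' = ⊥-elim (¬d' (∣-trans (^G-mono-∣ p e>e') d))

exactPower-split : ∀ {p e y} → ExactPower p e y → Σ GI λ u → (y ≡ (p ^G e) *G u) × ¬ p ∣ u
exactPower-split {p} {e} (divides u refl , ¬d) = u , refl , λ p∣u →
  ¬d (subst (_∣ ((p ^G e) *G u)) (sym (^G-sucʳ p e)) (∣-*G (∣-refl (p ^G e)) p∣u))

exactPower-*G : ∀ {p e₁ e₂ y₁ y₂} → IsPrime p → ExactPower p e₁ y₁ → ExactPower p e₂ y₂ → ExactPower p (e₁ ℕ.+ e₂) (y₁ *G y₂)
exactPower-*G {p} {e₁} {e₂} p-prime x₁ x₂ with exactPower-split x₁ | exactPower-split x₂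
... | u₁ , refl , p∤u₁ | u₂ , refl , p∤u₂ = subst (p^e ∣_) (sym regroup) (x∣x*y p^e (u₁ *G u₂)) , p^e⁺¹∤
  where
  p^e = p ^G (e₁ ℕ.+ e₂)
  regroup : ((p ^G e₁) *G u₁) *G ((p ^G e₂) *G u₂) ≡ p^e *G (u₁ *G u₂)
  regroup = trans (*G-interchange (p ^G e₁) u₁ (p ^G e₂) u₂) (cong (_*G (u₁ *G u₂)) (sym (^G-+ p e₁ e₂)))
  p^e⁺¹∤ : ¬ (p ^G suc (e₁ ℕ.+ e₂)) ∣ ((p ^G e₁) *G u₁) *G ((p ^G e₂) *G u₂)
  p^e⁺¹∤ d = [ p∤u₁ , p∤u₂ ]′ (euclidsLemma p-prime u₁ u₂
    (∣-cancelˡ p (u₁ *G u₂) p^e (^G-nonzero p (e₁ ℕ.+ e₂) (prime-nonzero p-prime)) (subst₂ _∣_ (^G-sucʳ p (e₁ ℕ.+ e₂)) regroup d)))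

exactPower-1G : ∀ {p} → IsPrime p → ExactPower p 0 1G
exactPower-1G {p} p-prime = 1∣x 1G , λ d → prime-nonunit p-prime (unit (subst (_∣ 1G) (x^1≡x p) d))
  where
  unit : p ∣ 1G → IsUnit p
  unit (divides v e) = v , sym e

exactPower-*unit : ∀ {p e y} u → ExactPower p e y → IsUnit u → ExactPower p e (y *G u)
exactPower-*unit u (d , ¬d) u-unit = ∣-*ʳ u d , λ d' → ¬d (∣-unitʳ u u-unit d')

exactPower-prodG : ∀ {p} → IsPrime p → ∀ {k} (f : Fin k → GI) (e : Fin k → ℕ) → (∀ i → ExactPower p (e i) (f i)) → ExactPower p (sumFin e) (prodG f)
exactPower-prodG p-prime {zero}  f e _ = exactPower-1G p-prime
exactPower-prodG p-prime {suc k} f e x = exactPower-*G p-prime (x zero) (exactPower-prodG p-prime (λ i → f (suc i)) (λ i → e (suc i)) (λ i → x (suc i)))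

exactPower-∣⇒≤ : ∀ {p e y d} → ExactPower p e y → (p ^G d) ∣ y → d ℕ.≤ e
exactPower-∣⇒≤ {p} {e} {y} {d} (_ , p^e⁺¹∤y) p^d∣y with d ℕ.≤? e
... | yes d≤e = d≤e
... | no d≰e  = ⊥-elim (p^e⁺¹∤y (∣-trans (^G-mono-∣ p (ℕP.≰⇒> d≰e)) p^d∣y))

exactPower-≤⇒∣ : ∀ {p e y d} → ExactPower p e y → d ℕ.≤ e → (p ^G d) ∣ y
exactPower-≤⇒∣ {p} (p^e∣y , _) d≤e = ∣-trans (^G-mono-∣ p d≤e) p^e∣y

-- The number of levels 1 ≤ l ≤ L with p^l ∣ y: the valuation of y as soon as p^L ∤ y.
valuation : GI → ℕ → GI → ℕ
valuation p L y = sumLevels L (λ l → indicator ((p ^G l) ∣? y))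

exactPower-valuation : ∀ p L y → ¬ (p ^G L) ∣ y → ExactPower p (valuation p L y) y
exactPower-valuation p L y = downward-closed-count L (λ l → (p ^G l) ∣ y) (λ l → (p ^G l) ∣? y)
  (λ l d → ∣-trans (^G-mono-∣ p (ℕP.n≤1+n l)) d) (1∣x y)
  where
  count-all : ∀ L (P : ℕ → Set) (P? : ∀ l → Dec (P l)) → (∀ l → P (suc l) → P l) → P L → sumLevels L (λ l → indicator (P? l)) ≡ L
  count-all zero    P P? _    _  = refl
  count-all (suc L) P P? down pL with P? (suc L)
  ... | yes _ = cong suc (count-all L P P? down (down L pL))
  ... | no ¬p = ⊥-elim (¬p pL)
  downward-closed-count : ∀ L (P : ℕ → Set) (P? : ∀ l → Dec (P l)) → (∀ l → P (suc l) → P l) → P 0 → ¬ P L →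
    let c = sumLevels L (λ l → indicator (P? l)) in P c × ¬ P (suc c)
  downward-closed-count zero    P P? _    p0 ¬pL = ⊥-elim (¬pL p0)
  downward-closed-count (suc L) P P? down p0 ¬pL with P? (suc L)
  ... | yes p = ⊥-elim (¬pL p)
  ... | no _ with P? L
  ... | yes pL = subst (λ z → P z × ¬ P (suc z)) (sym (count-all L P P? down pL)) (pL , ¬pL)
  ... | no ¬pL' = downward-closed-count L P P? down p0 ¬pL'


-- Congruences, residue counts and complete residue systems

-- A record rather than α ∣ (u -G v) itself, so that u, v and α can be inferred.
infix 4 _≡_[mod_] _≡?_[mod_]
record _≡_[mod_] (u v α : GI) : Set where
  constructor ∣⇒≡mod
  field
    ≡mod⇒∣ : α ∣ (u -G v)
open _≡_[mod_] public

_≡?_[mod_] : ∀ u v α → Dec (u ≡ v [mod α ])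
u ≡? v [mod α ] = map′ ∣⇒≡mod ≡mod⇒∣ (α ∣? (u -G v))

≡mod-refl : ∀ α u → u ≡ u [mod α ]
≡mod-refl α u = ∣⇒≡mod (subst (α ∣_) (sym (x-x≡0 u)) (x∣0 α))

≡mod-sym : ∀ {α u v} → u ≡ v [mod α ] → v ≡ u [mod α ]
≡mod-sym {α} {u} {v} (∣⇒≡mod (divides x e)) = ∣⇒≡mod (divides (negG x) (begin
  v -G u           ≡⟨ sym (negG[x-y]≡y-x u v) ⟩
  negG (u -G v)    ≡⟨ cong negG e ⟩
  negG (α *G x)    ≡⟨ negG-distribʳ-*G α x ⟩
  α *G negG x      ∎))
  where open ≡-Reasoning

≡mod-trans : ∀ {α u v w} → u ≡ v [mod α ] → v ≡ w [mod α ] → u ≡ w [mod α ]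
≡mod-trans {α} {u} {v} {w} (∣⇒≡mod u≡v) (∣⇒≡mod v≡w) = ∣⇒≡mod (subst (α ∣_) (sym (telescope u v w)) (∣-+ u≡v v≡w))
  where
  open GISolver using (solve; _⊕_; ⊝_; _⊜_)
  telescope : ∀ u v w → u -G w ≡ (u -G v) +G (v -G w)
  telescope = solve 3 (λ u v w → (u ⊕ (⊝ w)) ⊜ ((u ⊕ (⊝ v)) ⊕ (v ⊕ (⊝ w)))) refl

count : ∀ {k} → (Fin k → GI) → GI → GI → ℕ
count x α r = sumFin (λ j → indicator (x j ≡? r [mod α ]))

count-cong : ∀ {k} (x : Fin k → GI) α {r s} → r ≡ s [mod α ] → count x α r ≡ count x α s
count-cong x α {r} {s} r≡s = sumFin-cong (λ j → indicator-cong (x j ≡? r [mod α ]) (x j ≡? s [mod α ])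
  (λ xj≡r → ≡mod-trans xj≡r r≡s) (λ xj≡s → ≡mod-trans xj≡s (≡mod-sym r≡s)))

∣Subset∣≡sumFin : ∀ {k} (S : Subset k) (P : Fin k → Set) (P? : ∀ j → Dec (P j)) →
  (∀ j → (j Subset.∈ S) ⇔ P j) → Subset.∣ S ∣ ≡ sumFin (λ j → indicator (P? j))
∣Subset∣≡sumFin {zero}  []      P P? _ = refl
∣Subset∣≡sumFin {suc k} (b ∷ S) P P? S≈P = trans (head b S≈P) (cong (indicator (P? zero) ℕ.+_)
  (∣Subset∣≡sumFin S (λ j → P (suc j)) (λ j → P? (suc j))
    (λ j → mk⇔ (λ j∈S → Equivalence.to (S≈P (suc j)) (there j∈S)) (λ pj → tail (Equivalence.from (S≈P (suc j)) pj)))))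
  where
  tail : ∀ {j} → (suc j) Subset.∈ (b ∷ S) → j Subset.∈ S
  tail (there j∈S) = j∈S
  head : ∀ b → (∀ j → (j Subset.∈ (b ∷ S)) ⇔ P j) → Subset.∣ b ∷ S ∣ ≡ indicator (P? zero) ℕ.+ Subset.∣ S ∣
  head true  S≈P' = cong (ℕ._+ Subset.∣ S ∣) (sym (indicator-yes (P? zero) (Equivalence.to (S≈P' zero) here)))
  head false S≈P' = cong (ℕ._+ Subset.∣ S ∣) (sym (indicator-no (P? zero) (λ p0 → 0∉ (Equivalence.from (S≈P' zero) p0))))
    where
    0∉ : ¬ (zero Subset.∈ (false ∷ S))
    0∉ ()

Subset-of : ∀ {k} (P : Fin k → Set) (P? : ∀ j → Dec (P j)) → Σ (Subset k) λ S → (∀ j → (j Subset.∈ S) ⇔ P j)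
Subset-of {zero}  P P? = [] , λ ()
Subset-of {suc k} P P? with Subset-of (λ j → P (suc j)) (λ j → P? (suc j)) | P? zero
... | S , S≈P | yes p0 = (true ∷ S) , λ
  { zero    → mk⇔ (λ _ → p0) (λ _ → here)
  ; (suc j) → mk⇔ (λ { (there j∈S) → Equivalence.to (S≈P j) j∈S }) (λ pj → there (Equivalence.from (S≈P j) pj)) }
... | S , S≈P | no ¬p0 = (false ∷ S) , λ
  { zero    → mk⇔ (λ ()) (λ p0 → ⊥-elim (¬p0 p0))
  ; (suc j) → mk⇔ (λ { (there j∈S) → Equivalence.to (S≈P j) j∈S }) (λ pj → there (Equivalence.from (S≈P j) pj)) }

hasCount⇒≡count : ∀ {k} (x : Fin k → GI) α r a → HasCount x α r a → a ≡ count x α r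
hasCount⇒≡count x α r a (S , refl , S≈) = ∣Subset∣≡sumFin S (λ j → x j ≡ r [mod α ]) (λ j → x j ≡? r [mod α ])
  (λ j → mk⇔ (λ j∈S → ∣⇒≡mod (∣G⇒∣ (Equivalence.to (S≈ j) j∈S))) (λ d → Equivalence.from (S≈ j) (∣⇒∣G (≡mod⇒∣ d))))

hasCount-count : ∀ {k} (x : Fin k → GI) α r → HasCount x α r (count x α r)
hasCount-count x α r with Subset-of (λ j → x j ≡ r [mod α ]) (λ j → x j ≡? r [mod α ])
... | S , S≈ = S , ∣Subset∣≡sumFin S _ _ S≈ , λ j → mk⇔ (λ j∈S → ∣⇒∣G (≡mod⇒∣ (Equivalence.to (S≈ j) j∈S))) (λ d → Equivalence.from (S≈ j) (∣⇒≡mod (∣G⇒∣ d)))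

AlmostUniformCounts : ∀ {k} → (Fin k → GI) → GI → Set
AlmostUniformCounts x α = ∀ r s → count x α r ℕ.≤ suc (count x α s)

counts⇒almostUniform : ∀ {k} (x : Fin k → GI) α → AlmostUniformCounts x α → AlmostUniform x α
counts⇒almostUniform x α uniform r s a b a≡ b≡ =
  subst₂ (λ u v → u ℕ.≤ suc v) (sym (hasCount⇒≡count x α r a a≡)) (sym (hasCount⇒≡count x α s b b≡)) (uniform r s)

almostUniform⇒counts : ∀ {k} (x : Fin k → GI) α → AlmostUniform x α → AlmostUniformCounts x α
almostUniform⇒counts x α uniform r s = uniform r s (count x α r) (count x α s) (hasCount-count x α r) (hasCount-count x α s)

range : ℕ → List ℕ
range zero    = []
range (suc M) = M ∷ range M

range-∈ : ∀ {k M} → k ℕ.< M → k ∈ range M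
range-∈ {k} {suc M} k<1+M with ℕP.m≤n⇒m<n∨m≡n (ℕP.≤-pred k<1+M)
... | inj₁ k<M  = there (range-∈ k<M)
... | inj₂ refl = here refl

pairs : List ℕ → List ℕ → List GI
pairs []       ys = []
pairs (a ∷ xs) ys = map (λ b → (+ a) +i (+ b)) ys ++ pairs xs ys

pairs-∈ : ∀ {a b xs ys} → a ∈ xs → b ∈ ys → ((+ a) +i (+ b)) ∈ pairs xs ys
pairs-∈ {a} {b} {x ∷ xs} {ys} (here refl) b∈ys = ∈-++⁺ˡ (∈-map⁺ (λ b → (+ a) +i (+ b)) b∈ys)
pairs-∈ {a} {b} {x ∷ xs} {ys} (there a∈xs) b∈ys = ∈-++⁺ʳ (map (λ b → (+ x) +i (+ b)) ys) (pairs-∈ a∈xs b∈ys)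

-- Every z is congruent modulo α to (re z mod N α) + (im z mod N α) i, since N α = α ᾱ.
candidates : ℕ → List GI
candidates M = pairs (range M) (range M)

candidates-cover : ∀ α → ¬ α ≡ 0G → ∀ z → Σ GI λ t → t ∈ candidates ∥ α ∥ × z ≡ t [mod α ]
candidates-cover α α≢0 z = t , pairs-∈ (range-∈ (ℤD.n%ℕd<d (re z) M)) (range-∈ (ℤD.n%ℕd<d (im z) M)) , ∣⇒≡mod (divides (conj α *G q) z-t≡αᾱq)
  where
  M = ∥ α ∥
  instance
    M≢0 : ℕ.NonZero M
    M≢0 = ℕ.≢-nonZero (λ e → α≢0 (∥x∥≡0⇒x≡0 α e))
  q = (re z ℤ./ℕ M) +i (im z ℤ./ℕ M)
  t = (+ (re z ℤ.%ℕ M)) +i (+ (im z ℤ.%ℕ M))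
  remainders : ∀ (u v : ℤ) M a b q₁ q₂ → u ≡ + a + q₁ * + M → v ≡ + b + q₂ * + M →
               (u +i v) -G ((+ a) +i (+ b)) ≡ ((+ M) +i (+ 0)) *G (q₁ +i q₂)
  remainders u v M a b q₁ q₂ refl refl = cong₂ _+i_ (re-eq (+ a) q₁ (+ M) q₂) (im-eq (+ b) q₂ (+ M) q₁)
    where
    re-eq : ∀ a q₁ M q₂ → (a + q₁ * M) - a ≡ M * q₁ - + 0 * q₂
    re-eq = solve-∀
    im-eq : ∀ b q₂ M q₁ → (b + q₂ * M) - b ≡ M * q₂ + + 0 * q₁
    im-eq = solve-∀
  z-t≡αᾱq : z -G t ≡ α *G (conj α *G q)
  z-t≡αᾱq = trans (remainders (re z) (im z) M _ _ _ _ (ℤD.a≡a%ℕn+[a/ℕn]*n (re z) M) (ℤD.a≡a%ℕn+[a/ℕn]*n (im z) M))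
              (trans (cong (_*G q) (sym (x*conj-x≡∥x∥ α))) (*G-assoc α (conj α) q))

-- Keeps one element of each class modulo α that meets the list.
module Dedup (α : GI) where
  Incongruent : List GI → Set
  Incongruent = AllPairs (λ u v → ¬ u ≡ v [mod α ])

  step : (t : GI) → (r : List GI) → Dec (Any (t ≡_[mod α ]) r) → List GI
  step t r (yes _) = r
  step t r (no _)  = t ∷ r

  dedup : List GI → List GI
  dedup []       = []
  dedup (t ∷ ts) = step t (dedup ts) (any? (t ≡?_[mod α ]) (dedup ts))

  step-⊇ : ∀ t r d {x} → x ∈ r → x ∈ step t r d
  step-⊇ t r (yes _) x∈r = x∈r
  step-⊇ t r (no _)  x∈r = there x∈r

  step-represents : ∀ t r d → Σ GI λ t' → t' ∈ step t r d × t ≡ t' [mod α ]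
  step-represents t r (yes t≡some) = find t≡some
  step-represents t r (no _)       = t , here refl , ≡mod-refl α t

  dedup-represents : ∀ ts {t} → t ∈ ts → Σ GI λ t' → t' ∈ dedup ts × t ≡ t' [mod α ]
  dedup-represents (u ∷ us) (here refl) = step-represents u (dedup us) (any? (u ≡?_[mod α ]) (dedup us))
  dedup-represents (u ∷ us) (there t∈us) with dedup-represents us t∈us
  ... | t' , t'∈ , t≡t' = t' , step-⊇ u (dedup us) (any? (u ≡?_[mod α ]) (dedup us)) t'∈ , t≡t'

  step-incongruent : ∀ t r d → Incongruent r → Incongruent (step t r d)
  step-incongruent t r (yes _) r-inc = r-inc
  step-incongruent t r (no ¬any) r-inc = ¬Any⇒All¬ r ¬any ∷ r-inc

  dedup-incongruent : ∀ ts → Incongruent (dedup ts)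
  dedup-incongruent []       = []
  dedup-incongruent (t ∷ ts) = step-incongruent t (dedup ts) (any? (t ≡?_[mod α ]) (dedup ts)) (dedup-incongruent ts)

record ResidueSystem (α : GI) : Set where
  constructor residueSystemOf
  field
    R           : List GI
    represents  : ∀ z → Σ GI λ t → t ∈ R × z ≡ t [mod α ]
    incongruent : AllPairs (λ u v → ¬ u ≡ v [mod α ]) R

residueSystem : ∀ α → ¬ α ≡ 0G → ResidueSystem α
residueSystem α α≢0 = residueSystemOf R represents (Dedup.dedup-incongruent α (candidates ∥ α ∥))
  where
  R = Dedup.dedup α (candidates ∥ α ∥)
  represents : ∀ z → Σ GI λ t → t ∈ R × z ≡ t [mod α ]
  represents z =
    let t , t∈ , z≡t = candidates-cover α α≢0 z
        t' , t'∈ , t≡t' = Dedup.dedup-represents α (candidates ∥ α ∥) t∈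
    in t' , t'∈ , ≡mod-trans z≡t t≡t'

sumList-select : ∀ {α} (S : ResidueSystem α) z (f : GI → ℕ) → (∀ {t t'} → t ≡ t' [mod α ] → f t ≡ f t') →
                 sumList (ResidueSystem.R S) (λ t → indicator (z ≡? t [mod α ]) ℕ.* f t) ≡ f z
sumList-select {α} (residueSystemOf R represents incongruent) z f f-cong =
  let t , t∈R , z≡t = represents z in trans (select R incongruent t∈R z≡t) (f-cong (≡mod-sym z≡t))
  where
  select : ∀ R → AllPairs (λ u v → ¬ u ≡ v [mod α ]) R → ∀ {t} → t ∈ R → z ≡ t [mod α ] →
           sumList R (λ t → indicator (z ≡? t [mod α ]) ℕ.* f t) ≡ f t
  select (t ∷ R) (t≢R ∷ _) (here refl) z≡t = trans (cong₂ ℕ._+_ (cong (ℕ._* f t) (indicator-yes (z ≡? t [mod α ]) z≡t))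
    (sumList-0 R _ (λ t' t'∈R → cong (ℕ._* f t') (indicator-no (z ≡? t' [mod α ]) (λ z≡t' → All.lookup t≢R t'∈R (≡mod-trans (≡mod-sym z≡t) z≡t'))))))
    (trans (ℕP.+-identityʳ _) (ℕP.+-identityʳ (f t)))
  select (u ∷ R) (u≢R ∷ R-inc) (there t∈R) z≡t = trans
    (cong (ℕ._+ sumList R (λ t → indicator (z ≡? t [mod α ]) ℕ.* f t))
      (cong (ℕ._* f u) (indicator-no (z ≡? u [mod α ]) (λ z≡u → All.lookup u≢R t∈R (≡mod-trans (≡mod-sym z≡u) z≡t)))))
    (select R R-inc t∈R z≡t)

sumList-indicator≡1 : ∀ {α} (S : ResidueSystem α) z → sumList (ResidueSystem.R S) (λ t → indicator (z ≡? t [mod α ])) ≡ 1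
sumList-indicator≡1 {α} S z = trans (sumList-cong (ResidueSystem.R S) (λ t _ → sym (ℕP.*-identityʳ _))) (sumList-select S z (λ _ → 1) (λ _ → refl))

sumList-count : ∀ {α} (S : ResidueSystem α) {k} (x : Fin k → GI) → sumList (ResidueSystem.R S) (count x α) ≡ k
sumList-count {α} S {k} x = trans (sumList-sumFin-comm (ResidueSystem.R S) (λ t j → indicator (x j ≡? t [mod α ])))
  (trans (sumFin-cong (λ j → sumList-indicator≡1 S (x j))) (sumFin-1 k))


prodG-zero : ∀ {k} (f : Fin k → GI) i → f i ≡ 0G → prodG f ≡ 0G
prodG-zero f zero    e = trans (cong (_*G prodG (λ i → f (suc i))) e) (*G-zeroˡ (prodG (λ i → f (suc i))))
prodG-zero f (suc i) e = trans (cong (f zero *G_) (prodG-zero (λ i → f (suc i)) i e)) (*G-zeroʳ (f zero))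

prodG-nonzero : ∀ {k} (f : Fin k → GI) → (∀ i → ¬ f i ≡ 0G) → ¬ prodG f ≡ 0G
prodG-nonzero {zero}  f _ ()
prodG-nonzero {suc k} f f≢0 = *G-nonzero (f zero) _ (f≢0 zero) (prodG-nonzero (λ i → f (suc i)) (λ i → f≢0 (suc i)))

-- π c j x = ∏_{i ≠ j} (x − c i), the numerator of the j-th Lagrange basis polynomial of the nodes c.
π : ∀ {n} → (Fin (suc n) → GI) → Fin (suc n) → GI → GI
π c j x = prodG (λ i → x -G c (punchIn j i))

LagrangeDivisible : ∀ {n} → (Fin (suc n) → GI) → Set
LagrangeDivisible c = ∀ j x → π c j (c j) ∣ π c j x

π-at-node-nonzero : ∀ {n} (c : Fin (suc n) → GI) → Injective _≡_ _≡_ c → ∀ j → ¬ π c j (c j) ≡ 0G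
π-at-node-nonzero c c-injective j = prodG-nonzero (λ i → c j -G c (punchIn j i))
  (λ i e → FP.punchInᵢ≢i j i (c-injective (sym (x-y≡0⇒x≡y _ _ e))))

π-at-other-node : ∀ {n} (c : Fin (suc n) → GI) j i → ¬ i ≡ j → π c j (c i) ≡ 0G
π-at-other-node c j i i≢j = prodG-zero (λ i' → c i -G c (punchIn j i')) (punchOut j≢i)
  (trans (cong (λ t → c i -G c t) (FP.punchIn-punchOut j≢i)) (x-x≡0 (c i)))
  where
  j≢i : ¬ j ≡ i
  j≢i e = i≢j (sym e)

spread : ∀ {k} → (Fin k → GI) → ℕ
spread x = sumFin (λ i → sumFin (λ i' → ∥ x i -G x i' ∥))

∥x-x∥≤spread : ∀ {k} (x : Fin k → GI) i i' → ∥ x i -G x i' ∥ ℕ.≤ spread x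
∥x-x∥≤spread x i i' = ℕP.≤-trans (sumFin-term (λ i' → ∥ x i -G x i' ∥) i') (sumFin-term (λ i → sumFin (λ i' → ∥ x i -G x i' ∥)) i)

-- triangle a = a (a - 1) / 2, the number of pairs among a points.
triangle : ℕ → ℕ
triangle zero    = 0
triangle (suc a) = a ℕ.+ triangle a

triangle-indicator : ∀ {P : Set} (d : Dec P) a → triangle (indicator d ℕ.+ a) ≡ indicator d ℕ.* a ℕ.+ triangle a
triangle-indicator (yes _) a = cong (ℕ._+ triangle a) (sym (ℕP.+-identityʳ a))
triangle-indicator (no _)  a = refl

triangle-+ : ∀ t d → triangle (t ℕ.+ d) ≡ triangle t ℕ.+ t ℕ.* d ℕ.+ triangle d
triangle-+ zero    d = refl
triangle-+ (suc t) d = trans (cong (t ℕ.+ d ℕ.+_) (triangle-+ t d)) (regroup t d (triangle t) (triangle d))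
  where
  regroup : ∀ t d T D → t ℕ.+ d ℕ.+ (T ℕ.+ t ℕ.* d ℕ.+ D) ≡ t ℕ.+ T ℕ.+ suc t ℕ.* d ℕ.+ D
  regroup = NS.solve-∀

triangle-double : ∀ t → triangle t ℕ.+ triangle t ℕ.+ t ≡ t ℕ.* t
triangle-double zero    = refl
triangle-double (suc t) = trans (regroup t (triangle t)) (trans (cong (λ z → z ℕ.+ t ℕ.+ suc t) (triangle-double t)) (square t))
  where
  regroup : ∀ t T → t ℕ.+ T ℕ.+ (t ℕ.+ T) ℕ.+ suc t ≡ (T ℕ.+ T ℕ.+ t) ℕ.+ t ℕ.+ suc t
  regroup = NS.solve-∀
  square : ∀ t → t ℕ.* t ℕ.+ t ℕ.+ suc t ≡ suc t ℕ.* suc t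
  square = NS.solve-∀

-- Convexity of triangle: triangle a ≥ a t - triangle (t + 1), with equality iff a ∈ {t, t + 1}
-- (stated with both sides moved so that no subtraction occurs).
triangle-excess : ∀ a t → Σ ℕ λ φ → (triangle a ℕ.+ (triangle t ℕ.+ t) ≡ a ℕ.* t ℕ.+ φ) × (φ ≡ 0 → a ≡ t ⊎ a ≡ suc t)
triangle-excess a t with ℕP.≤-total t a
... | inj₁ t≤a = triangle d , subst (λ z → triangle z ℕ.+ (triangle t ℕ.+ t) ≡ z ℕ.* t ℕ.+ triangle d) t+d≡a
      (trans (cong (ℕ._+ (triangle t ℕ.+ t)) (triangle-+ t d)) (rearrange t d (triangle t) (triangle d) (triangle-double t))) , d≤1
  where
  d = a ℕ.∸ t
  t+d≡a : t ℕ.+ d ≡ a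
  t+d≡a = ℕP.m+[n∸m]≡n t≤a
  rearrange : ∀ t d T D → T ℕ.+ T ℕ.+ t ≡ t ℕ.* t → (T ℕ.+ t ℕ.* d ℕ.+ D) ℕ.+ (T ℕ.+ t) ≡ (t ℕ.+ d) ℕ.* t ℕ.+ D
  rearrange t d T D 2T+t≡t² = trans (shuffle t d T D) (trans (cong (λ z → z ℕ.+ t ℕ.* d ℕ.+ D) 2T+t≡t²) (factor t d D))
    where
    shuffle : ∀ t d T D → (T ℕ.+ t ℕ.* d ℕ.+ D) ℕ.+ (T ℕ.+ t) ≡ (T ℕ.+ T ℕ.+ t) ℕ.+ t ℕ.* d ℕ.+ D
    shuffle = NS.solve-∀
    factor : ∀ t d D → t ℕ.* t ℕ.+ t ℕ.* d ℕ.+ D ≡ (t ℕ.+ d) ℕ.* t ℕ.+ D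
    factor = NS.solve-∀
  d≤1 : triangle d ≡ 0 → a ≡ t ⊎ a ≡ suc t
  d≤1 T≡0 with d in d≡
  ... | zero          = inj₁ (trans (sym t+d≡a) (trans (cong (t ℕ.+_) d≡) (ℕP.+-identityʳ t)))
  ... | suc zero      = inj₂ (trans (sym t+d≡a) (trans (cong (t ℕ.+_) d≡) (ℕP.+-comm t 1)))
  ... | suc (suc _) with T≡0
  ... | ()
... | inj₂ a≤t = triangle (suc e) , subst (λ z → triangle a ℕ.+ (triangle z ℕ.+ z) ≡ a ℕ.* z ℕ.+ triangle (suc e)) a+e≡t
      (trans (cong (λ z → triangle a ℕ.+ (z ℕ.+ (a ℕ.+ e))) (triangle-+ a e)) (rearrange a e (triangle a) (triangle e) (triangle-double a))) , e≡0
  where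
  e = t ℕ.∸ a
  a+e≡t : a ℕ.+ e ≡ t
  a+e≡t = ℕP.m+[n∸m]≡n a≤t
  rearrange : ∀ a e A E → A ℕ.+ A ℕ.+ a ≡ a ℕ.* a → A ℕ.+ ((A ℕ.+ a ℕ.* e ℕ.+ E) ℕ.+ (a ℕ.+ e)) ≡ a ℕ.* (a ℕ.+ e) ℕ.+ (e ℕ.+ E)
  rearrange a e A E 2A+a≡a² = trans (shuffle a e A E) (trans (cong (λ z → z ℕ.+ a ℕ.* e ℕ.+ (e ℕ.+ E)) 2A+a≡a²) (factor a e E))
    where
    shuffle : ∀ a e A E → A ℕ.+ ((A ℕ.+ a ℕ.* e ℕ.+ E) ℕ.+ (a ℕ.+ e)) ≡ (A ℕ.+ A ℕ.+ a) ℕ.+ a ℕ.* e ℕ.+ (e ℕ.+ E)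
    shuffle = NS.solve-∀
    factor : ∀ a e E → a ℕ.* a ℕ.+ a ℕ.* e ℕ.+ (e ℕ.+ E) ≡ a ℕ.* (a ℕ.+ e) ℕ.+ (e ℕ.+ E)
    factor = NS.solve-∀
  e≡0 : triangle (suc e) ≡ 0 → a ≡ t ⊎ a ≡ suc t
  e≡0 T≡0 = inj₁ (trans (sym (ℕP.+-identityʳ a)) (trans (cong (a ℕ.+_) (sym (ℕP.m+n≡0⇒m≡0 e T≡0))) a+e≡t))

triangle-excess-zero : ∀ a t → a ≡ t ⊎ a ≡ suc t → triangle a ℕ.+ (triangle t ℕ.+ t) ≡ a ℕ.* t
triangle-excess-zero a t (inj₁ refl) = trans (sym (ℕP.+-assoc (triangle t) (triangle t) t)) (triangle-double t)
triangle-excess-zero a t (inj₂ refl) = trans (regroup t (triangle t)) (trans (cong (ℕ._+ t) (triangle-double t)) (square t))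
  where
  regroup : ∀ t T → (t ℕ.+ T) ℕ.+ (T ℕ.+ t) ≡ (T ℕ.+ T ℕ.+ t) ℕ.+ t
  regroup = NS.solve-∀
  square : ∀ t → t ℕ.* t ℕ.+ t ≡ suc t ℕ.* t
  square = NS.solve-∀

between : ∀ {t a} → t ℕ.≤ a → a ℕ.≤ suc t → a ≡ t ⊎ a ≡ suc t
between t≤a a≤1+t with ℕP.m≤n⇒m<n∨m≡n a≤1+t
... | inj₂ a≡1+t = inj₂ a≡1+t
... | inj₁ a<1+t = inj₁ (ℕP.≤-antisym (ℕP.≤-pred a<1+t) t≤a)

within : ∀ {t a b} → a ≡ t ⊎ a ≡ suc t → b ≡ t ⊎ b ≡ suc t → a ℕ.≤ suc b
within (inj₁ refl) (inj₁ refl) = ℕP.n≤1+n _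
within (inj₁ refl) (inj₂ refl) = ℕP.≤-trans (ℕP.n≤1+n _) (ℕP.n≤1+n _)
within (inj₂ refl) (inj₁ refl) = ℕP.≤-refl
within (inj₂ refl) (inj₂ refl) = ℕP.n≤1+n _

-- Refining residue classes modulo p^h into classes modulo p^(h+1)

count-level0 : ∀ {k} (x : Fin k → GI) p y → count x (p ^G 0) y ≡ k
count-level0 {k} x p y = trans (sumFin-cong (λ j → indicator-yes (x j ≡? y [mod 1G ]) (∣⇒≡mod (1∣x _)))) (sumFin-1 k)

≡mod-^G-weaken : ∀ p {h h'} {u v} → h ℕ.≤ h' → u ≡ v [mod p ^G h' ] → u ≡ v [mod p ^G h ]
≡mod-^G-weaken p h≤h' (∣⇒≡mod u≡v) = ∣⇒≡mod (∣-trans (^G-mono-∣ p h≤h') u≡v)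

child-≡mod : ∀ α y t → (y +G α *G t) ≡ y [mod α ]
child-≡mod α y t = ∣⇒≡mod (subst (α ∣_) (sym (x+y-x≡y y (α *G t))) (x∣x*y α t))

module _ (p : GI) (p-prime : IsPrime p) where
  p≢0 : ¬ p ≡ 0G
  p≢0 = prime-nonzero p-prime

  Sₚ : ResidueSystem p
  Sₚ = residueSystem p p≢0

  Rₚ : List GI
  Rₚ = ResidueSystem.R Sₚ

  -- The children of the class of y modulo p^h are the classes of y + p^h t, t ∈ Rₚ.
  child-≡mod⇔ : ∀ h x y w t → x -G y ≡ (p ^G h) *G w → (x ≡ (y +G (p ^G h) *G t) [mod p ^G suc h ]) ⇔ (w ≡ t [mod p ])
  child-≡mod⇔ h x y w t x-y≡pʰw = mk⇔
    (λ x≡child → ∣⇒≡mod (∣-cancelˡ p (w -G t) (p ^G h) (^G-nonzero p h p≢0) (subst₂ _∣_ (^G-sucʳ p h) x-child≡pʰ[w-t] (≡mod⇒∣ x≡child))))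
    (λ w≡t → ∣⇒≡mod (subst₂ _∣_ (sym (^G-sucʳ p h)) (sym x-child≡pʰ[w-t]) (∣-*G (∣-refl (p ^G h)) (≡mod⇒∣ w≡t))))
    where
    x-child≡pʰ[w-t] : x -G (y +G (p ^G h) *G t) ≡ (p ^G h) *G (w -G t)
    x-child≡pʰ[w-t] = trans (x-[y+z]≡x-y-z x y _) (trans (cong (_-G (p ^G h) *G t) x-y≡pʰw) (sym (*G-distribˡ--G (p ^G h) w t)))

  child-≢mod : ∀ h x y t → ¬ x ≡ y [mod p ^G h ] → ¬ x ≡ (y +G (p ^G h) *G t) [mod p ^G suc h ]
  child-≢mod h x y t x≢y x≡child = x≢y (∣⇒≡mod (subst ((p ^G h) ∣_) (regroup x y _)
    (∣-+ (≡mod⇒∣ (≡mod-^G-weaken p (ℕP.n≤1+n h) x≡child)) (x∣x*y (p ^G h) t))))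
    where
    open GISolver using (solve; _⊕_; ⊝_; _⊜_)
    regroup : ∀ x y a → (x -G (y +G a)) +G a ≡ x -G y
    regroup = solve 3 (λ x y a → ((x ⊕ (⊝ (y ⊕ a))) ⊕ a) ⊜ (x ⊕ (⊝ y))) refl

  indicator-children : ∀ h x y → indicator (x ≡? y [mod p ^G h ])
                       ≡ sumList Rₚ (λ t → indicator (x ≡? (y +G (p ^G h) *G t) [mod p ^G suc h ]))
  indicator-children h x y = children (x ≡? y [mod p ^G h ])
    where
    children : (d : Dec (x ≡ y [mod p ^G h ])) → indicator d ≡ sumList Rₚ (λ t → indicator (x ≡? (y +G (p ^G h) *G t) [mod p ^G suc h ]))
    children (yes (∣⇒≡mod (divides w x-y≡pʰw))) = sym (trans
      (sumList-cong Rₚ (λ t _ → indicator-cong (x ≡? (y +G (p ^G h) *G t) [mod p ^G suc h ]) (w ≡? t [mod p ])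
        (Equivalence.to (child-≡mod⇔ h x y w t x-y≡pʰw)) (Equivalence.from (child-≡mod⇔ h x y w t x-y≡pʰw))))
      (sumList-indicator≡1 Sₚ w))
    children (no x≢y) = sym (sumList-0 Rₚ _ (λ t _ → indicator-no (x ≡? (y +G (p ^G h) *G t) [mod p ^G suc h ]) (child-≢mod h x y t x≢y)))

  count-children : ∀ {k} (x : Fin k → GI) h y → count x (p ^G h) y ≡ sumList Rₚ (λ t → count x (p ^G suc h) (y +G (p ^G h) *G t))
  count-children x h y = trans (sumFin-cong (λ j → indicator-children h (x j) y))
    (sym (sumList-sumFin-comm Rₚ (λ t j → indicator (x j ≡? (y +G (p ^G h) *G t) [mod p ^G suc h ]))))

  t₀ : GI
  t₀ = proj₁ (ResidueSystem.represents Sₚ 0G)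

  t₀∈Rₚ : t₀ ∈ Rₚ
  t₀∈Rₚ = proj₁ (proj₂ (ResidueSystem.represents Sₚ 0G))

  child-t₀-≡mod : ∀ h y → y ≡ (y +G (p ^G h) *G t₀) [mod p ^G suc h ]
  child-t₀-≡mod h y = Equivalence.from (child-≡mod⇔ h y y 0G t₀ (trans (x-x≡0 y) (sym (*G-zeroʳ (p ^G h)))))
    (proj₂ (proj₂ (ResidueSystem.represents Sₚ 0G)))

  UnbalancedSiblings : ∀ {k} → (Fin k → GI) → Set
  UnbalancedSiblings x = Σ ℕ λ l → Σ GI λ a → Σ GI λ b →
    a ≡ b [mod p ^G l ] × (2 ℕ.+ count x (p ^G suc l) b ℕ.≤ count x (p ^G suc l) a)

  -- Going down one level: either two children of r or of s are already unbalanced against their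
  -- parent, or the children of r dominate those of s pairwise and stay unbalanced at t₀.
  unbalanced⇒unbalancedSiblings : ∀ {k} (x : Fin k → GI) h r s → 2 ℕ.+ count x (p ^G h) s ℕ.≤ count x (p ^G h) r → UnbalancedSiblings x
  unbalanced⇒unbalancedSiblings {k} x zero r s unbalanced = ⊥-elim (ℕP.<-irrefl refl
    (ℕP.<-≤-trans (ℕP.m<n+m k (s≤s z≤n)) (subst₂ (λ u v → 2 ℕ.+ u ℕ.≤ v) (count-level0 x p s) (count-level0 x p r) unbalanced)))
  unbalanced⇒unbalancedSiblings {k} x (suc l) r s unbalanced =
    step-down (any? (λ t → (2 ℕ.+ N (r +G (p ^G l) *G t)) ℕ.≤? N r) Rₚ) (any? (λ t → (2 ℕ.+ N s) ℕ.≤? N (s +G (p ^G l) *G t)) Rₚ)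
    where
    N = count x (p ^G suc l)
    ≰⇒≤1+ : ∀ {a b} → ¬ (2 ℕ.+ a ℕ.≤ b) → b ℕ.≤ 1 ℕ.+ a
    ≰⇒≤1+ ≰ = ℕP.≤-pred (ℕP.≰⇒> ≰)
    step-down : Dec (Any (λ t → 2 ℕ.+ N (r +G (p ^G l) *G t) ℕ.≤ N r) Rₚ) →
              Dec (Any (λ t → 2 ℕ.+ N s ℕ.≤ N (s +G (p ^G l) *G t)) Rₚ) → UnbalancedSiblings x
    step-down (yes child-r) _ = let t , _ , ineq = find child-r in
      l , r , r +G (p ^G l) *G t , ≡mod-sym (child-≡mod (p ^G l) r t) , ineq
    step-down (no _) (yes child-s) = let t , _ , ineq = find child-s in
      l , s +G (p ^G l) *G t , s , child-≡mod (p ^G l) s t , ineq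
    step-down (no ¬child-r) (no ¬child-s) = unbalanced⇒unbalancedSiblings x l r s
      (subst₂ (λ u v → 2 ℕ.+ u ℕ.≤ v) (sym (count-children x l s)) (sym (count-children x l r))
        (sumList-mono-≤-+2 Rₚ t₀∈Rₚ children-dominate at-t₀))
      where
      children-dominate : ∀ t → t ∈ Rₚ → N (s +G (p ^G l) *G t) ℕ.≤ N (r +G (p ^G l) *G t)
      children-dominate t t∈ = ℕP.≤-pred (ℕP.≤-pred (ℕP.≤-trans (s≤s (s≤s (≰⇒≤1+ (λ q → ¬child-s (lose t∈ q)))))
        (ℕP.≤-trans (s≤s unbalanced) (s≤s (≰⇒≤1+ (λ q → ¬child-r (lose t∈ q)))))))
      at-t₀ : 2 ℕ.+ N (s +G (p ^G l) *G t₀) ℕ.≤ N (r +G (p ^G l) *G t₀)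
      at-t₀ = subst₂ (λ u v → 2 ℕ.+ u ℕ.≤ v) (count-cong x (p ^G suc l) (child-t₀-≡mod l s)) (count-cong x (p ^G suc l) (child-t₀-≡mod l r)) unbalanced


  -- Pick a fullest child of U and an emptiest child of W: the children's counts sum to the
  -- parents' counts, so a strict inequality between parents survives between these children.
  descent-step : ∀ {k} (x : Fin k → GI) h U W → suc (count x (p ^G h) W) ℕ.≤ count x (p ^G h) U →
    Σ GI λ tU → Σ GI λ tW → suc (count x (p ^G suc h) (W +G (p ^G h) *G tW)) ℕ.≤ count x (p ^G suc h) (U +G (p ^G h) *G tU)
  descent-step x h U W W<U = tU , tW , W'<U'
    where
    N = count x (p ^G suc h)
    fullest = argmax Rₚ (λ t → N (U +G (p ^G h) *G t)) t₀∈Rₚ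
    emptiest = argmin Rₚ (λ t → N (W +G (p ^G h) *G t)) t₀∈Rₚ
    tU = proj₁ fullest
    tW = proj₁ emptiest
    W'<U' : suc (N (W +G (p ^G h) *G tW)) ℕ.≤ N (U +G (p ^G h) *G tU)
    W'<U' = decidable-stable (suc (N (W +G (p ^G h) *G tW)) ℕ.≤? N (U +G (p ^G h) *G tU)) λ ≮ →
      ℕP.<⇒≱ W<U (subst₂ ℕ._≤_ (sym (count-children x h U)) (sym (count-children x h W))
        (sumList-mono-≤ Rₚ (λ t t∈ → ℕP.≤-trans (proj₂ (proj₂ fullest) t t∈)
          (ℕP.≤-trans (ℕP.≤-pred (ℕP.≰⇒> ≮)) (proj₂ (proj₂ emptiest) t t∈)))))

  record Descent {k} (x : Fin k → GI) (l L : ℕ) : Set where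
    constructor descent
    field
      U W        : GI
      W<U        : ∀ h → suc l ℕ.≤ h → h ℕ.≤ L → suc (count x (p ^G h) W) ℕ.≤ count x (p ^G h) U
      2+W≤U      : 2 ℕ.+ count x (p ^G suc l) W ℕ.≤ count x (p ^G suc l) U
      siblings   : U ≡ W [mod p ^G l ]

  descend : ∀ {k} (x : Fin k → GI) l a b → a ≡ b [mod p ^G l ] → 2 ℕ.+ count x (p ^G suc l) b ℕ.≤ count x (p ^G suc l) a →
            ∀ d → Descent x l (suc l ℕ.+ d)
  descend x l a b a≡b 2+b≤a zero = descent a b b<a 2+b≤a a≡b
    where
    b<a : ∀ h → suc l ℕ.≤ h → h ℕ.≤ suc l ℕ.+ 0 → suc (count x (p ^G h) b) ℕ.≤ count x (p ^G h) a
    b<a h l<h h≤l+1 with ℕP.≤-antisym l<h (subst (h ℕ.≤_) (ℕP.+-identityʳ (suc l)) h≤l+1)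
    ... | refl = ℕP.<⇒≤ 2+b≤a
  descend x l a b a≡b 2+b≤a (suc d) with descend x l a b a≡b 2+b≤a d
  ... | descent U W W<U 2+W≤U U≡W with descent-step x (suc l ℕ.+ d) U W (W<U (suc l ℕ.+ d) (ℕP.m≤m+n (suc l) d) ℕP.≤-refl)
  ... | tU , tW , W'<U' = descent U' W' W'<U'-below 2+W'≤U' U'≡W'
    where
    L = suc l ℕ.+ d
    U' = U +G (p ^G L) *G tU
    W' = W +G (p ^G L) *G tW
    U'≡U : ∀ h → h ℕ.≤ L → U' ≡ U [mod p ^G h ]
    U'≡U h h≤L = ≡mod-^G-weaken p h≤L (child-≡mod (p ^G L) U tU)
    W'≡W : ∀ h → h ℕ.≤ L → W' ≡ W [mod p ^G h ]
    W'≡W h h≤L = ≡mod-^G-weaken p h≤L (child-≡mod (p ^G L) W tW)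
    W'<U'-below : ∀ h → suc l ℕ.≤ h → h ℕ.≤ suc l ℕ.+ suc d → suc (count x (p ^G h) W') ℕ.≤ count x (p ^G h) U'
    W'<U'-below h l<h h≤L+1 with ℕP.m≤n⇒m<n∨m≡n (subst (h ℕ.≤_) (cong suc (ℕP.+-suc l d)) h≤L+1)
    ... | inj₁ h<L+1 = subst₂ (λ u v → suc u ℕ.≤ v) (sym (count-cong x (p ^G h) (W'≡W h (ℕP.≤-pred h<L+1))))
                         (sym (count-cong x (p ^G h) (U'≡U h (ℕP.≤-pred h<L+1)))) (W<U h l<h (ℕP.≤-pred h<L+1))
    ... | inj₂ refl = W'<U'
    2+W'≤U' : 2 ℕ.+ count x (p ^G suc l) W' ℕ.≤ count x (p ^G suc l) U'
    2+W'≤U' = subst₂ (λ u v → 2 ℕ.+ u ℕ.≤ v) (sym (count-cong x (p ^G suc l) (W'≡W (suc l) (ℕP.m≤m+n (suc l) d))))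
                (sym (count-cong x (p ^G suc l) (U'≡U (suc l) (ℕP.m≤m+n (suc l) d)))) 2+W≤U
    l≤L : l ℕ.≤ L
    l≤L = ℕP.≤-trans (ℕP.n≤1+n l) (ℕP.m≤m+n (suc l) d)
    U'≡W' : U' ≡ W' [mod p ^G l ]
    U'≡W' = ≡mod-trans (U'≡U l l≤L) (≡mod-trans U≡W (≡mod-sym (W'≡W l l≤L)))


  DistinctModulo : ∀ {k} → ℕ → (Fin k → GI) → Set
  DistinctModulo L x = ∀ i i' → ¬ i ≡ i' → ¬ (p ^G L) ∣ (x i -G x i')

  distinct-mod-^G : ∀ {k} (x : Fin k → GI) → Injective _≡_ _≡_ x → ∀ L → spread x ℕ.≤ L → DistinctModulo L x
  distinct-mod-^G x x-injective L spread≤L i i' i≢i' =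
    ^G-∤ p-prime (x i -G x i') (x≢y⇒x-y≢0 (λ e → i≢i' (x-injective e))) L (ℕP.≤-trans (∥x-x∥≤spread x i i') spread≤L)

  -- The nodes other than c j, and their counts; at level h these give the p-adic valuation of π c j.
  module Punctured {n} (c : Fin (suc n) → GI) (j : Fin (suc n)) where
    c' : Fin n → GI
    c' i = c (punchIn j i)

    count' : ℕ → GI → ℕ
    count' h z = count c' (p ^G h) z

    count-split : ∀ h z → count c (p ^G h) z ≡ indicator (c j ≡? z [mod p ^G h ]) ℕ.+ count' h z
    count-split h z = sumFin-punchIn j (λ i → indicator (c i ≡? z [mod p ^G h ]))

    count'≤count : ∀ h z → count' h z ℕ.≤ count c (p ^G h) z
    count'≤count h z = subst (count' h z ℕ.≤_) (sym (count-split h z)) (ℕP.m≤n+m _ _)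

    count-at-node : ∀ h → count c (p ^G h) (c j) ≡ suc (count' h (c j))
    count-at-node h = trans (count-split h (c j)) (cong (ℕ._+ count' h (c j)) (indicator-yes (c j ≡? c j [mod p ^G h ]) (≡mod-refl (p ^G h) (c j))))

    exactPower-π : ∀ L x → (∀ i → ¬ (p ^G L) ∣ (x -G c' i)) → ExactPower p (sumLevels L (λ h → count' h x)) (π c j x)
    exactPower-π L x p^L∤ = subst (λ e → ExactPower p e (π c j x)) valuations≡counts
      (exactPower-prodG p-prime (λ i → x -G c' i) (λ i → valuation p L (x -G c' i)) (λ i → exactPower-valuation p L (x -G c' i) (p^L∤ i)))
      where
      valuations≡counts : sumFin (λ i → valuation p L (x -G c' i)) ≡ sumLevels L (λ h → count' h x)
      valuations≡counts = trans (sumFin-sumLevels-comm L (λ i h → indicator ((p ^G h) ∣? (x -G c' i))))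
        (sumLevels-cong L (λ h → sumFin-cong (λ i → indicator-cong ((p ^G h) ∣? (x -G c' i)) (c' i ≡? x [mod p ^G h ])
          (λ d → ≡mod-sym (∣⇒≡mod d)) (λ ci≡x → ≡mod⇒∣ (≡mod-sym ci≡x)))))

    π-at-node-∤ : Injective _≡_ _≡_ c → ∀ L → spread c ℕ.≤ L → ∀ i → ¬ (p ^G L) ∣ (c j -G c' i)
    π-at-node-∤ c-injective L spread≤L i = distinct-mod-^G c c-injective L spread≤L j (punchIn j i) (λ e → FP.punchInᵢ≢i j i (sym e))

  -- If two sibling classes were unbalanced, descend to a level L where every class contains at
  -- most one node. The class of U then holds a single node c j and the class of W none, so that
  -- counting level by level, v_p (π c j W) < v_p (π c j (c j)), contradicting divisibility.
  lagrangeDivisible⇒balancedSiblings : ∀ {n} (c : Fin (suc n) → GI) → Injective _≡_ _≡_ c → LagrangeDivisible c → ¬ UnbalancedSiblings c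
  lagrangeDivisible⇒balancedSiblings {n} c c-injective divisible (l , a , b , a≡b , 2+b≤a) =
    ℕP.<⇒≱ e<E (exactPower-∣⇒≤ (exactPower-π L W W-far) (∣-trans (exactPower-≤⇒∣ exact-at-node ℕP.≤-refl) (divisible j W)))
    where
    L = suc l ℕ.+ spread c
    l<L : suc l ℕ.≤ L
    l<L = ℕP.m≤m+n (suc l) (spread c)
    spread≤L : spread c ℕ.≤ L
    spread≤L = ℕP.m≤n+m (spread c) (suc l)
    D = descend c l a b a≡b 2+b≤a (spread c)
    open Descent D
    W<U-at-L : suc (count c (p ^G L) W) ℕ.≤ count c (p ^G L) U
    W<U-at-L = W<U L l<L ℕP.≤-refl
    node∈U = sumFin-indicator≥1⇒∃ (λ i → c i ≡ U [mod p ^G L ]) (λ i → c i ≡? U [mod p ^G L ]) (ℕP.≤-trans (s≤s z≤n) W<U-at-L)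
    j = proj₁ node∈U
    open Punctured c j
    U≡cj : ∀ h → h ℕ.≤ L → U ≡ c j [mod p ^G h ]
    U≡cj h h≤L = ≡mod-^G-weaken p h≤L (≡mod-sym (proj₂ node∈U))
    count-U : ∀ h → h ℕ.≤ L → count c (p ^G h) U ≡ suc (count' h (c j))
    count-U h h≤L = trans (count-cong c (p ^G h) (U≡cj h h≤L)) (count-at-node h)
    count'-cj-at-L : count' L (c j) ≡ 0
    count'-cj-at-L = trans (sumFin-cong (λ i → indicator-no (c' i ≡? c j [mod p ^G L ])
      (λ ci≡cj → π-at-node-∤ c-injective L spread≤L i (≡mod⇒∣ (≡mod-sym ci≡cj))))) (sumFin-0 n)
    W-empty : count c (p ^G L) W ℕ.≤ 0
    W-empty = ℕP.≤-pred (subst (suc (count c (p ^G L) W) ℕ.≤_) (trans (count-U L ℕP.≤-refl) (cong suc count'-cj-at-L)) W<U-at-L)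
    W-far : ∀ i → ¬ (p ^G L) ∣ (W -G c' i)
    W-far i W≡ci = sumFin-indicator≤0⇒∄ (λ i → c i ≡ W [mod p ^G L ]) (λ i → c i ≡? W [mod p ^G L ]) W-empty (punchIn j i) (≡mod-sym (∣⇒≡mod W≡ci))
    exact-at-node = exactPower-π L (c j) (π-at-node-∤ c-injective L spread≤L)
    W≤node : ∀ h → 1 ℕ.≤ h → h ℕ.≤ L → count' h W ℕ.≤ count' h (c j)
    W≤node h _ h≤L = by-level (h ℕ.≤? l)
      where
      by-level : Dec (h ℕ.≤ l) → count' h W ℕ.≤ count' h (c j)
      by-level (yes h≤l) = ℕP.≤-reflexive (ℕP.suc-injective (trans (sym (trans (count-split h W)
          (cong (ℕ._+ count' h W) (indicator-yes (c j ≡? W [mod p ^G h ]) (≡mod-sym W≡cj)))))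
          (trans (count-cong c (p ^G h) W≡cj) (count-at-node h))))
        where
        W≡cj : W ≡ c j [mod p ^G h ]
        W≡cj = ≡mod-trans (≡mod-^G-weaken p h≤l (≡mod-sym siblings)) (U≡cj h h≤L)
      by-level (no h≰l) = ℕP.≤-pred (ℕP.≤-trans (s≤s (count'≤count h W)) (subst (suc (count c (p ^G h) W) ℕ.≤_) (count-U h h≤L) (W<U h (ℕP.≰⇒> h≰l) h≤L)))
    W<node : suc (count' (suc l) W) ℕ.≤ count' (suc l) (c j)
    W<node = ℕP.≤-pred (ℕP.≤-trans (s≤s (s≤s (count'≤count (suc l) W))) (subst (2 ℕ.+ count c (p ^G suc l) W ℕ.≤_) (count-U (suc l) l<L) 2+W≤U))
    e<E : suc (sumLevels L (λ h → count' h W)) ℕ.≤ sumLevels L (λ h → count' h (c j))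
    e<E = sumLevels-mono-< L W≤node (suc l) (s≤s z≤n) l<L W<node

  lagrangeDivisible⇒almostUniform : ∀ {n} (c : Fin (suc n) → GI) → Injective _≡_ _≡_ c → LagrangeDivisible c → ∀ h → AlmostUniformCounts c (p ^G h)
  lagrangeDivisible⇒almostUniform c c-injective divisible h r s = decidable-stable (count c (p ^G h) r ℕ.≤? suc (count c (p ^G h) s))
    λ r≰1+s → lagrangeDivisible⇒balancedSiblings c c-injective divisible (unbalanced⇒unbalancedSiblings c h r s (ℕP.≰⇒> r≰1+s))

  -- Almost uniformity makes every class hold at least as many other nodes as the class of c j,
  -- so v_p (π c j (c j)) ≤ v_p (π c j x) level by level.
  almostUniform⇒π-∣ : ∀ {n} (c : Fin (suc n) → GI) → Injective _≡_ _≡_ c → (∀ h → AlmostUniformCounts c (p ^G h)) →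
                      ∀ j x e → (p ^G e) ∣ π c j (c j) → (p ^G e) ∣ π c j x
  almostUniform⇒π-∣ c c-injective uniform j x e p^e∣node = by-cases (π c j x ≟G 0G)
    where
    open Punctured c j
    L = spread c ℕ.+ sumFin (λ i → ∥ x -G c i ∥)
    exact-at-node = exactPower-π L (c j) (π-at-node-∤ c-injective L (ℕP.m≤m+n (spread c) _))
    node≤x : ∀ h → count' h (c j) ℕ.≤ count' h x
    node≤x h = by-class (c j ≡? x [mod p ^G h ])
      where
      by-class : Dec (c j ≡ x [mod p ^G h ]) → count' h (c j) ℕ.≤ count' h x
      by-class (yes cj≡x) = ℕP.≤-reflexive (ℕP.suc-injective (trans (sym (count-at-node h))
        (trans (sym (count-cong c (p ^G h) (≡mod-sym cj≡x))) (trans (count-split h x) (cong (ℕ._+ count' h x) (indicator-yes (c j ≡? x [mod p ^G h ]) cj≡x))))))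
      by-class (no cj≢x) = ℕP.≤-pred (subst₂ (λ u v → u ℕ.≤ suc v) (count-at-node h)
        (trans (count-split h x) (cong (ℕ._+ count' h x) (indicator-no (c j ≡? x [mod p ^G h ]) cj≢x))) (uniform h (c j) x))
    by-cases : Dec (π c j x ≡ 0G) → (p ^G e) ∣ π c j x
    by-cases (yes π≡0) = subst ((p ^G e) ∣_) (sym π≡0) (x∣0 (p ^G e))
    by-cases (no π≢0) = exactPower-≤⇒∣ (exactPower-π L x x-far) (ℕP.≤-trans (exactPower-∣⇒≤ exact-at-node p^e∣node) (sumLevels-mono-≤ L node≤x))
      where
      x-far : ∀ i → ¬ (p ^G L) ∣ (x -G c' i)
      x-far i = ^G-∤ p-prime (x -G c' i) (λ x≡ci → π≢0 (prodG-zero (λ i → x -G c' i) i x≡ci)) L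
        (ℕP.≤-trans (sumFin-term (λ i → ∥ x -G c i ∥) (punchIn j i)) (ℕP.m≤n+m _ (spread c)))

  -- The number of pairs i < i' with x i ≡ x i' (mod p^h), following the recursion of vol.
  pairCount : ∀ {k} → ℕ → (Fin k → GI) → ℕ
  pairCount {zero}  h x = 0
  pairCount {suc k} h x = count (λ j → x (suc j)) (p ^G h) (x zero) ℕ.+ pairCount h (λ j → x (suc j))

  exactPower-vol : ∀ {k} L (x : Fin k → GI) → DistinctModulo L x → ExactPower p (sumLevels L (λ h → pairCount h x)) (vol x)
  exactPower-vol {zero}  L x _ = subst (λ e → ExactPower p e 1G) (sym (sumLevels-0 L)) (exactPower-1G p-prime)
  exactPower-vol {suc k} L x distinct = subst (λ e → ExactPower p e (vol x)) valuations≡pairs (exactPower-*G p-prime first rest)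
    where
    x' : Fin k → GI
    x' j = x (suc j)
    first : ExactPower p (sumFin (λ j → valuation p L (x zero -G x' j))) (prodG (λ j → x zero -G x' j))
    first = exactPower-prodG p-prime (λ j → x zero -G x' j) (λ j → valuation p L (x zero -G x' j)) (λ j → exactPower-valuation p L _ (distinct zero (suc j) (λ ())))
    rest = exactPower-vol L x' (λ i i' i≢i' → distinct (suc i) (suc i') (λ e → i≢i' (FP.suc-injective e)))
    valuations≡pairs : sumFin (λ j → valuation p L (x zero -G x' j)) ℕ.+ sumLevels L (λ h → pairCount h x') ≡ sumLevels L (λ h → pairCount h x)
    valuations≡pairs = trans (cong (ℕ._+ sumLevels L (λ h → pairCount h x'))
      (trans (sumFin-sumLevels-comm L (λ j h → indicator ((p ^G h) ∣? (x zero -G x' j))))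
        (sumLevels-cong L (λ h → sumFin-cong (λ j → indicator-cong ((p ^G h) ∣? (x zero -G x' j)) (x' j ≡? x zero [mod p ^G h ])
          (λ d → ≡mod-sym (∣⇒≡mod d)) (λ xj≡x0 → ≡mod⇒∣ (≡mod-sym xj≡x0)))))))
      (sym (sumLevels-+ L _ _))

  residueSystem-^G : ∀ h → ResidueSystem (p ^G h)
  residueSystem-^G h = residueSystem (p ^G h) (^G-nonzero p h p≢0)

  pairCount≡sumTriangle : ∀ {k} h (x : Fin k → GI) → pairCount h x ≡ sumList (ResidueSystem.R (residueSystem-^G h)) (λ r → triangle (count x (p ^G h) r))
  pairCount≡sumTriangle {zero}  h x = sym (sumList-0 (ResidueSystem.R (residueSystem-^G h)) _ (λ _ _ → refl))
  pairCount≡sumTriangle {suc k} h x = sym (trans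
    (sumList-cong R (λ r _ → triangle-indicator (x zero ≡? r [mod α ]) (count x' α r)))
    (trans (sumList-+ R (λ r → indicator (x zero ≡? r [mod α ]) ℕ.* count x' α r) (λ r → triangle (count x' α r)))
      (cong₂ ℕ._+_ (sumList-select (residueSystem-^G h) (x zero) (count x' α) (count-cong x' α)) (sym (pairCount≡sumTriangle h x')))))
    where
    α = p ^G h
    R = ResidueSystem.R (residueSystem-^G h)
    x' : Fin k → GI
    x' j = x (suc j)

  -- Among families of the same size, an almost uniform one has the fewest congruent pairs,
  -- and any family with as few is almost uniform too (convexity of triangle).
  pairCount-minimal : ∀ {m} (C B : Fin m → GI) h → AlmostUniformCounts C (p ^G h) →
    (pairCount h C ℕ.≤ pairCount h B) × (pairCount h C ≡ pairCount h B → AlmostUniformCounts B (p ^G h))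
  pairCount-minimal {m} C B h C-uniform = C≤B , C≡B⇒B-uniform
    where
    α = p ^G h
    S = residueSystem-^G h
    R = ResidueSystem.R S
    smallest = argmin R (count C α) (proj₁ (proj₂ (ResidueSystem.represents S 0G)))
    t = count C α (proj₁ smallest)
    C-near-t : ∀ r → r ∈ R → count C α r ≡ t ⊎ count C α r ≡ suc t
    C-near-t r r∈R = between (proj₂ (proj₂ smallest) r r∈R) (C-uniform r (proj₁ smallest))
    excess : GI → ℕ
    excess r = proj₁ (triangle-excess (count B α r) t)
    TC = sumList R (λ r → triangle (count C α r))
    TB = sumList R (λ r → triangle (count B α r))
    Σc = sumList R (λ _ → triangle t ℕ.+ t)
    TC+c≡mt : TC ℕ.+ Σc ≡ m ℕ.* t
    TC+c≡mt = trans (sym (sumList-+ R (λ r → triangle (count C α r)) (λ _ → triangle t ℕ.+ t)))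
      (trans (sumList-cong R (λ r r∈R → triangle-excess-zero (count C α r) t (C-near-t r r∈R)))
        (trans (sumList-*ʳ R (count C α) t) (cong (ℕ._* t) (sumList-count S C))))
    TB+c≡mt+excess : TB ℕ.+ Σc ≡ m ℕ.* t ℕ.+ sumList R excess
    TB+c≡mt+excess = trans (sym (sumList-+ R (λ r → triangle (count B α r)) (λ _ → triangle t ℕ.+ t)))
      (trans (sumList-cong R (λ r _ → proj₁ (proj₂ (triangle-excess (count B α r) t))))
        (trans (sumList-+ R (λ r → count B α r ℕ.* t) excess)
          (cong (ℕ._+ sumList R excess) (trans (sumList-*ʳ R (count B α) t) (cong (ℕ._* t) (sumList-count S B))))))
    TC+excess≡TB : TC ℕ.+ sumList R excess ≡ TB
    TC+excess≡TB = ℕP.+-cancelʳ-≡ Σc (TC ℕ.+ sumList R excess) TB (begin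
      TC ℕ.+ sumList R excess ℕ.+ Σc   ≡⟨ ℕP.+-assoc TC _ Σc ⟩
      TC ℕ.+ (sumList R excess ℕ.+ Σc) ≡⟨ cong (TC ℕ.+_) (ℕP.+-comm (sumList R excess) Σc) ⟩
      TC ℕ.+ (Σc ℕ.+ sumList R excess) ≡⟨ sym (ℕP.+-assoc TC Σc _) ⟩
      TC ℕ.+ Σc ℕ.+ sumList R excess   ≡⟨ cong (ℕ._+ sumList R excess) TC+c≡mt ⟩
      m ℕ.* t ℕ.+ sumList R excess     ≡⟨ sym TB+c≡mt+excess ⟩
      TB ℕ.+ Σc                        ∎)
      where open ≡-Reasoning
    C≤B : pairCount h C ℕ.≤ pairCount h B
    C≤B = subst₂ ℕ._≤_ (sym (pairCount≡sumTriangle h C)) (trans TC+excess≡TB (sym (pairCount≡sumTriangle h B))) (ℕP.m≤m+n TC _)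
    C≡B⇒B-uniform : pairCount h C ≡ pairCount h B → AlmostUniformCounts B α
    C≡B⇒B-uniform C≡B r s = subst₂ (λ u v → u ℕ.≤ suc v) (sym (count-cong B α (proj₂ (proj₂ rep-r)))) (sym (count-cong B α (proj₂ (proj₂ rep-s))))
      (within (B-near-t _ (proj₁ (proj₂ rep-r))) (B-near-t _ (proj₁ (proj₂ rep-s))))
      where
      no-excess : sumList R excess ≡ 0
      no-excess = ℕP.+-cancelˡ-≡ TC (sumList R excess) 0 (trans (trans TC+excess≡TB
        (trans (sym (pairCount≡sumTriangle h B)) (trans (sym C≡B) (pairCount≡sumTriangle h C)))) (sym (ℕP.+-identityʳ TC)))
      B-near-t : ∀ r → r ∈ R → count B α r ≡ t ⊎ count B α r ≡ suc t
      B-near-t r r∈R = proj₂ (proj₂ (triangle-excess (count B α r) t)) (sumList≡0⇒ R excess no-excess r r∈R)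
      rep-r = ResidueSystem.represents S r
      rep-s = ResidueSystem.represents S s

  -- Both volumes have valuation Σ_h pairCount h, once the level bound exceeds both spreads.
  module VolumeComparison {m} (C B : Fin m → GI) (C-injective : Injective _≡_ _≡_ C) (B-injective : Injective _≡_ _≡_ B)
                          (C-uniform : ∀ h → AlmostUniformCounts C (p ^G h)) where
    levels : ℕ → ℕ
    levels h = spread C ℕ.+ spread B ℕ.+ h

    exact-C : ∀ h → ExactPower p (sumLevels (levels h) (λ l → pairCount l C)) (vol C)
    exact-C h = exactPower-vol (levels h) C (distinct-mod-^G C C-injective (levels h) (ℕP.≤-trans (ℕP.m≤m+n (spread C) (spread B)) (ℕP.m≤m+n _ h)))

    exact-B : ∀ h → ExactPower p (sumLevels (levels h) (λ l → pairCount l B)) (vol B)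
    exact-B h = exactPower-vol (levels h) B (distinct-mod-^G B B-injective (levels h) (ℕP.≤-trans (ℕP.m≤n+m (spread B) (spread C)) (ℕP.m≤m+n _ h)))

    C≤B : ∀ L l → 1 ℕ.≤ l → l ℕ.≤ L → pairCount l C ℕ.≤ pairCount l B
    C≤B L l _ _ = proj₁ (pairCount-minimal C B l (C-uniform l))

    ^G-∣vol : ∀ e → (p ^G e) ∣ vol C → (p ^G e) ∣ vol B
    ^G-∣vol e p^e∣C = exactPower-≤⇒∣ (exact-B 0) (ℕP.≤-trans (exactPower-∣⇒≤ (exact-C 0) p^e∣C) (sumLevels-mono-≤' (levels 0) (C≤B (levels 0))))

    associate⇒almostUniform : ∀ u → IsUnit u → vol B ≡ vol C *G u → ∀ h → 1 ℕ.≤ h → AlmostUniformCounts B (p ^G h)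
    associate⇒almostUniform u u-unit B≡Cu h 1≤h = proj₂ (pairCount-minimal C B h (C-uniform h))
      (sumLevels-≡⇒≡ (levels h) (C≤B (levels h)) same-valuation h 1≤h (ℕP.m≤n+m h _))
      where
      same-valuation : sumLevels (levels h) (λ l → pairCount l C) ≡ sumLevels (levels h) (λ l → pairCount l B)
      same-valuation = exactPower-unique (subst (ExactPower p _) (sym B≡Cu) (exactPower-*unit u (exact-C h) u-unit)) (exact-B h)


module ℚSolver = Tactic.RingSolver.NonReflective (TACR.fromCommutativeRing ℚP.+-*-commutativeRing (λ x → dec⇒maybe (0ℚ ℚP.≟ x)))

-- The embedding ℤ → ℚ as it occurs in Defs' embed; ι-mkℚ is the same number built directly.
ι : ℤ → ℚ
ι a = a / 1

ι-mkℚ : ℤ → ℚ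
ι-mkℚ a = mkℚ a 0 (Cop.sym (Cop.1-coprimeTo _))

ι≡ι-mkℚ : ∀ a → ι a ≡ ι-mkℚ a
ι≡ι-mkℚ a = ℚP.↥p/↧p≡p (ι-mkℚ a)

ι-+ : ∀ a b → ι (a ℤ.+ b) ≡ ι a ℚ.+ ι b
ι-+ a b = sym (trans (cong₂ ℚ._+_ (ι≡ι-mkℚ a) (ι≡ι-mkℚ b)) (cong (_/ 1) (a*1+b*1≡a+b a b)))
  where
  a*1+b*1≡a+b : ∀ a b → a ℤ.* + 1 ℤ.+ b ℤ.* + 1 ≡ a ℤ.+ b
  a*1+b*1≡a+b = solve-∀

ι-* : ∀ a b → ι (a ℤ.* b) ≡ ι a ℚ.* ι b
ι-* a b = sym (trans (cong₂ ℚ._*_ (ι≡ι-mkℚ a) (ι≡ι-mkℚ b)) refl)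

ι-neg : ∀ a → ι (ℤ.- a) ≡ ℚ.- ι a
ι-neg a = trans (ι≡ι-mkℚ (ℤ.- a)) (trans (ι-mkℚ-neg a) (cong ℚ.-_ (sym (ι≡ι-mkℚ a))))
  where
  ι-mkℚ-neg : ∀ a → ι-mkℚ (ℤ.- a) ≡ ℚ.- ι-mkℚ a
  ι-mkℚ-neg (+ zero)   = refl
  ι-mkℚ-neg +[1+ n ]   = refl
  ι-mkℚ-neg -[1+ n ]   = refl

ι-inj : ∀ {a b} → ι a ≡ ι b → a ≡ b
ι-inj {a} {b} e = cong ℚ.↥_ (trans (sym (ι≡ι-mkℚ a)) (trans e (ι≡ι-mkℚ b)))

0Q 1Q : QI
0Q = 0ℚ +iq 0ℚ
1Q = 1ℚ +iq 0ℚ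

negQ : QI → QI
negQ (a +iq b) = (ℚ.- a) +iq (ℚ.- b)

_-Q_ : QI → QI → QI
x -Q y = x +Q negQ y

module _ where
  open ℚSolver using (_⊕_; _⊗_; ⊝_; _⊜_; Κ)
  abstract
    +Q-assoc : ∀ x y z → (x +Q y) +Q z ≡ x +Q (y +Q z)
    +Q-assoc (a +iq b) (c +iq d) (e +iq f) = cong₂ _+iq_ (ℚP.+-assoc a c e) (ℚP.+-assoc b d f)
    +Q-comm : ∀ x y → x +Q y ≡ y +Q x
    +Q-comm (a +iq b) (c +iq d) = cong₂ _+iq_ (ℚP.+-comm a c) (ℚP.+-comm b d)
    +Q-identityˡ : ∀ x → 0Q +Q x ≡ x
    +Q-identityˡ (a +iq b) = cong₂ _+iq_ (ℚP.+-identityˡ a) (ℚP.+-identityˡ b)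
    +Q-identityʳ : ∀ x → x +Q 0Q ≡ x
    +Q-identityʳ (a +iq b) = cong₂ _+iq_ (ℚP.+-identityʳ a) (ℚP.+-identityʳ b)
    +Q-inverseˡ : ∀ x → negQ x +Q x ≡ 0Q
    +Q-inverseˡ (a +iq b) = cong₂ _+iq_ (ℚP.+-inverseˡ a) (ℚP.+-inverseˡ b)
    +Q-inverseʳ : ∀ x → x +Q negQ x ≡ 0Q
    +Q-inverseʳ (a +iq b) = cong₂ _+iq_ (ℚP.+-inverseʳ a) (ℚP.+-inverseʳ b)
    *Q-assoc : ∀ x y z → (x *Q y) *Q z ≡ x *Q (y *Q z)
    *Q-assoc (a +iq b) (c +iq d) (e +iq f) = cong₂ _+iq_
      (ℚSolver.solve 6 (λ a b c d e f → (((a ⊗ c) ⊕ (⊝ (b ⊗ d))) ⊗ e) ⊕ (⊝ (((a ⊗ d) ⊕ (b ⊗ c)) ⊗ f)) ⊜ ((a ⊗ ((c ⊗ e) ⊕ (⊝ (d ⊗ f)))) ⊕ (⊝ (b ⊗ ((c ⊗ f) ⊕ (d ⊗ e)))))) refl a b c d e f)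
      (ℚSolver.solve 6 (λ a b c d e f → (((a ⊗ c) ⊕ (⊝ (b ⊗ d))) ⊗ f) ⊕ (((a ⊗ d) ⊕ (b ⊗ c)) ⊗ e) ⊜ ((a ⊗ ((c ⊗ f) ⊕ (d ⊗ e))) ⊕ (b ⊗ ((c ⊗ e) ⊕ (⊝ (d ⊗ f)))))) refl a b c d e f)
    *Q-comm : ∀ x y → x *Q y ≡ y *Q x
    *Q-comm (a +iq b) (c +iq d) = cong₂ _+iq_
      (ℚSolver.solve 4 (λ a b c d → ((a ⊗ c) ⊕ (⊝ (b ⊗ d))) ⊜ ((c ⊗ a) ⊕ (⊝ (d ⊗ b)))) refl a b c d)
      (ℚSolver.solve 4 (λ a b c d → ((a ⊗ d) ⊕ (b ⊗ c)) ⊜ ((c ⊗ b) ⊕ (d ⊗ a))) refl a b c d)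
    *Q-distribˡ : ∀ x y z → x *Q (y +Q z) ≡ (x *Q y) +Q (x *Q z)
    *Q-distribˡ (a +iq b) (c +iq d) (e +iq f) = cong₂ _+iq_
      (ℚSolver.solve 6 (λ a b c d e f → ((a ⊗ (c ⊕ e)) ⊕ (⊝ (b ⊗ (d ⊕ f)))) ⊜ (((a ⊗ c) ⊕ (⊝ (b ⊗ d))) ⊕ ((a ⊗ e) ⊕ (⊝ (b ⊗ f))))) refl a b c d e f)
      (ℚSolver.solve 6 (λ a b c d e f → ((a ⊗ (d ⊕ f)) ⊕ (b ⊗ (c ⊕ e))) ⊜ (((a ⊗ d) ⊕ (b ⊗ c)) ⊕ ((a ⊗ f) ⊕ (b ⊗ e)))) refl a b c d e f)
    *Q-identityˡ : ∀ x → 1Q *Q x ≡ x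
    *Q-identityˡ (a +iq b) = cong₂ _+iq_
      (ℚSolver.solve 2 (λ a b → ((Κ 1ℚ ⊗ a) ⊕ (⊝ (Κ 0ℚ ⊗ b))) ⊜ a) refl a b)
      (ℚSolver.solve 2 (λ a b → ((Κ 1ℚ ⊗ b) ⊕ (Κ 0ℚ ⊗ a)) ⊜ b) refl a b)

*Q-distribʳ : ∀ x y z → (y +Q z) *Q x ≡ (y *Q x) +Q (z *Q x)
*Q-distribʳ x y z = trans (*Q-comm (y +Q z) x) (trans (*Q-distribˡ x y z) (cong₂ _+Q_ (*Q-comm x y) (*Q-comm x z)))
*Q-identityʳ : ∀ x → x *Q 1Q ≡ x
*Q-identityʳ x = trans (*Q-comm x 1Q) (*Q-identityˡ x)

+Q-*Q-isCommutativeRing : IsCommutativeRing _≡_ _+Q_ _*Q_ negQ 0Q 1Q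
+Q-*Q-isCommutativeRing = record
  { isRing = record
    { +-isAbelianGroup = record
      { isGroup = record
        { isMonoid = record
          { isSemigroup = record
            { isMagma = record { isEquivalence = isEquivalence ; ∙-cong = cong₂ _+Q_ }
            ; assoc = +Q-assoc }
          ; identity = +Q-identityˡ , +Q-identityʳ }
        ; inverse = +Q-inverseˡ , +Q-inverseʳ
        ; ⁻¹-cong = cong negQ }
      ; comm = +Q-comm }
    ; *-cong = cong₂ _*Q_
    ; *-assoc = *Q-assoc
    ; *-identity = *Q-identityˡ , *Q-identityʳ
    ; distrib = *Q-distribˡ , *Q-distribʳ }
  ; *-comm = *Q-comm }

+Q-*Q-commutativeRing : CommutativeRing _ _
+Q-*Q-commutativeRing = record { isCommutativeRing = +Q-*Q-isCommutativeRing }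

_≟Q_ : (x y : QI) → Dec (x ≡ y)
(a +iq b) ≟Q (c +iq d) with a ℚP.≟ c | b ℚP.≟ d
... | yes refl | yes refl = yes refl
... | no ne | _ = no λ { refl → ne refl }
... | yes _ | no ne = no λ { refl → ne refl }

module QISolver = Tactic.RingSolver.NonReflective (TACR.fromCommutativeRing +Q-*Q-commutativeRing (λ x → dec⇒maybe (0Q ≟Q x)))

embed-+ : ∀ x y → embed (x +G y) ≡ embed x +Q embed y
embed-+ (a +i b) (c +i d) = cong₂ _+iq_ (ι-+ a c) (ι-+ b d)

embed-* : ∀ x y → embed (x *G y) ≡ embed x *Q embed y
embed-* (a +i b) (c +i d) = cong₂ _+iq_
  (trans (ι-+ (a ℤ.* c) (ℤ.- (b ℤ.* d))) (cong₂ ℚ._+_ (ι-* a c) (trans (ι-neg (b ℤ.* d)) (cong ℚ.-_ (ι-* b d)))))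
  (trans (ι-+ (a ℤ.* d) (b ℤ.* c)) (cong₂ ℚ._+_ (ι-* a d) (ι-* b c)))

embed-neg : ∀ x → embed (negG x) ≡ negQ (embed x)
embed-neg (a +i b) = cong₂ _+iq_ (ι-neg a) (ι-neg b)

embed-- : ∀ x y → embed (x -G y) ≡ embed x -Q embed y
embed-- x y = trans (embed-+ x (negG y)) (cong (embed x +Q_) (embed-neg y))



embed-inj : ∀ {x y} → embed x ≡ embed y → x ≡ y
embed-inj {a +i b} {c +i d} e = cong₂ _+i_ (ι-inj (cong req e)) (ι-inj (cong imq e))


1/ℕ : (N : ℕ) → ¬ N ≡ 0 → ℚ
1/ℕ zero nz = ⊥-elim (nz refl)
1/ℕ (suc N) nz = ℚ.1/ (ι-mkℚ (+ suc N))

1/ℕ-inverseˡ : ∀ N nz → 1/ℕ N nz ℚ.* ι (+ N) ≡ 1ℚ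
1/ℕ-inverseˡ zero nz = ⊥-elim (nz refl)
1/ℕ-inverseˡ (suc N) nz = trans (cong (ℚ.1/ (ι-mkℚ (+ suc N)) ℚ.*_) (ι≡ι-mkℚ (+ suc N))) (ℚP.*-inverseˡ (ι-mkℚ (+ suc N)))

-- invQ d = conj d / N d, the inverse of d in ℚ(i).
invQ : (d : GI) → ¬ d ≡ 0G → QI
invQ (a +i b) nz = (ι a ℚ.* s) +iq (ι (ℤ.- b) ℚ.* s)
  where s = 1/ℕ ∥ a +i b ∥ (λ e → nz (∥x∥≡0⇒x≡0 (a +i b) e))

module _ where
  open ℚSolver using (_⊕_; _⊗_; ⊝_; _⊜_; Κ)
  abstract
    invQ-re : ∀ A B s → (A ℚ.* s) ℚ.* A ℚ.- ((ℚ.- B) ℚ.* s) ℚ.* B ≡ s ℚ.* (A ℚ.* A ℚ.+ B ℚ.* B)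
    invQ-re = ℚSolver.solve 3 (λ A B s → (((A ⊗ s) ⊗ A) ⊕ (⊝ (((⊝ B) ⊗ s) ⊗ B))) ⊜ (s ⊗ ((A ⊗ A) ⊕ (B ⊗ B)))) refl
    invQ-im : ∀ A B s → (A ℚ.* s) ℚ.* B ℚ.+ ((ℚ.- B) ℚ.* s) ℚ.* A ≡ 0ℚ
    invQ-im = ℚSolver.solve 3 (λ A B s → (((A ⊗ s) ⊗ B) ⊕ (((⊝ B) ⊗ s) ⊗ A)) ⊜ Κ 0ℚ) refl

invQ-inverseˡ : ∀ d nz → invQ d nz *Q embed d ≡ 1Q
invQ-inverseˡ (a +i b) nz = cong₂ _+iq_ re-part im-part
  where
  s = 1/ℕ ∥ a +i b ∥ (λ e → nz (∥x∥≡0⇒x≡0 (a +i b) e))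
  re-part : (ι a ℚ.* s) ℚ.* ι a ℚ.- (ι (ℤ.- b) ℚ.* s) ℚ.* ι b ≡ 1ℚ
  re-part = trans (cong (λ z → (ι a ℚ.* s) ℚ.* ι a ℚ.- (z ℚ.* s) ℚ.* ι b) (ι-neg b))
    (trans (invQ-re (ι a) (ι b) s)
    (trans (cong (s ℚ.*_) (sym (trans (ι-+ (a ℤ.* a) (b ℤ.* b)) (cong₂ ℚ._+_ (ι-* a a) (ι-* b b)))))
    (trans (cong (λ z → s ℚ.* ι z) (sym (+∥x∥≡norm (a +i b)))) (trans (ℚP.*-comm s _) (trans (ℚP.*-comm _ s) (1/ℕ-inverseˡ ∥ a +i b ∥ _))))))
  im-part : (ι a ℚ.* s) ℚ.* ι b ℚ.+ (ι (ℤ.- b) ℚ.* s) ℚ.* ι a ≡ 0ℚ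
  im-part = trans (cong (λ z → (ι a ℚ.* s) ℚ.* ι b ℚ.+ (z ℚ.* s) ℚ.* ι a) (ι-neg b)) (invQ-im (ι a) (ι b) s)

prodQ : ∀ {k} → (Fin k → QI) → QI
prodQ {zero} f = 1Q
prodQ {suc k} f = f zero *Q prodQ (λ i → f (suc i))

embed-prod : ∀ {k} (f : Fin k → GI) → embed (prodG f) ≡ prodQ (λ i → embed (f i))
embed-prod {zero} f = refl
embed-prod {suc k} f = trans (embed-* (f zero) _) (cong (embed (f zero) *Q_) (embed-prod (λ i → f (suc i))))

addV : ∀ {m} → Vec QI m → Vec QI m → Vec QI m
addV [] [] = []
addV (c ∷ cs) (d ∷ ds) = (c +Q d) ∷ addV cs ds

scaleV : ∀ {m} → QI → Vec QI m → Vec QI m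
scaleV k [] = []
scaleV k (c ∷ cs) = (k *Q c) ∷ scaleV k cs

padV : ∀ {m} → Vec QI m → Vec QI (suc m)
padV [] = 0Q ∷ []
padV (c ∷ cs) = c ∷ padV cs

mulLin : ∀ {m} → QI → Vec QI m → Vec QI (suc m)
mulLin a v = addV (0Q ∷ v) (scaleV (negQ a) (padV v))

prodLin : ∀ {k} → (Fin k → QI) → Vec QI (suc k)
prodLin {zero} a = 1Q ∷ []
prodLin {suc k} a = mulLin (a zero) (prodLin (λ i → a (suc i)))

module _ where
  open QISolver using (_⊕_; _⊗_; ⊝_; _⊜_; Κ)
  abstract
    horner-add : ∀ c d z E1 E2 → (c +Q d) +Q (z *Q (E1 +Q E2)) ≡ (c +Q (z *Q E1)) +Q (d +Q (z *Q E2))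
    horner-add = QISolver.solve 5 (λ c d z E1 E2 → ((c ⊕ d) ⊕ (z ⊗ (E1 ⊕ E2))) ⊜ ((c ⊕ (z ⊗ E1)) ⊕ (d ⊕ (z ⊗ E2)))) refl
    horner-scale : ∀ k c z E → (k *Q c) +Q (z *Q (k *Q E)) ≡ k *Q (c +Q (z *Q E))
    horner-scale = QISolver.solve 4 (λ k c z E → ((k ⊗ c) ⊕ (z ⊗ (k ⊗ E))) ⊜ (k ⊗ (c ⊕ (z ⊗ E)))) refl
    horner-zero : ∀ z → 0Q +Q (z *Q 0Q) ≡ 0Q
    horner-zero = QISolver.solve 1 (λ z → (Κ 0Q ⊕ (z ⊗ Κ 0Q)) ⊜ Κ 0Q) refl
    horner-linear : ∀ z a E → (0Q +Q (z *Q E)) +Q (negQ a *Q E) ≡ (z -Q a) *Q E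
    horner-linear = QISolver.solve 3 (λ z a E → ((Κ 0Q ⊕ (z ⊗ E)) ⊕ ((⊝ a) ⊗ E)) ⊜ ((z ⊕ (⊝ a)) ⊗ E)) refl
    horner-one : ∀ z → 1Q +Q (z *Q 0Q) ≡ 1Q
    horner-one = QISolver.solve 1 (λ z → (Κ 1Q ⊕ (z ⊗ Κ 0Q)) ⊜ Κ 1Q) refl

evalV-add : ∀ {m} (u v : Vec QI m) z → evalV (addV u v) z ≡ evalV u z +Q evalV v z
evalV-add [] [] z = sym (+Q-identityˡ _)
evalV-add (c ∷ cs) (d ∷ ds) z = trans (cong (λ w → (c +Q d) +Q (z *Q w)) (evalV-add cs ds z)) (horner-add c d z (evalV cs z) (evalV ds z))

evalV-scale : ∀ {m} k (v : Vec QI m) z → evalV (scaleV k v) z ≡ k *Q evalV v z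
evalV-scale k [] z = sym (trans (*Q-comm k 0Q) (zeroQ k))
  where
  zeroQ : ∀ k → 0Q *Q k ≡ 0Q
  zeroQ (a +iq b) = cong₂ _+iq_ (trans (cong₂ ℚ._-_ (ℚP.*-zeroˡ a) (ℚP.*-zeroˡ b)) refl) (trans (cong₂ ℚ._+_ (ℚP.*-zeroˡ b) (ℚP.*-zeroˡ a)) refl)
evalV-scale k (c ∷ cs) z = trans (cong (λ w → (k *Q c) +Q (z *Q w)) (evalV-scale k cs z)) (horner-scale k c z (evalV cs z))

evalV-pad : ∀ {m} (v : Vec QI m) z → evalV (padV v) z ≡ evalV v z
evalV-pad [] z = horner-zero z
evalV-pad (c ∷ cs) z = cong (λ w → c +Q (z *Q w)) (evalV-pad cs z)

evalV-mulLin : ∀ {m} a (v : Vec QI m) z → evalV (mulLin a v) z ≡ (z -Q a) *Q evalV v z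
evalV-mulLin a v z = trans (evalV-add (0Q ∷ v) (scaleV (negQ a) (padV v)) z) (trans (cong ((0Q +Q (z *Q evalV v z)) +Q_) (trans (evalV-scale (negQ a) (padV v) z) (cong (negQ a *Q_) (evalV-pad v z)))) (horner-linear z a (evalV v z)))

evalV-prodLin : ∀ {k} (a : Fin k → QI) z → evalV (prodLin a) z ≡ prodQ (λ i → z -Q a i)
evalV-prodLin {zero} a z = horner-one z
evalV-prodLin {suc k} a z = trans (evalV-mulLin (a zero) (prodLin (λ i → a (suc i))) z) (cong ((z -Q a zero) *Q_) (evalV-prodLin (λ i → a (suc i)) z))


divideByLinear : ∀ {m} → Vec QI (suc m) → QI → Vec QI m
divideByLinear (c ∷ []) a = []
divideByLinear (c ∷ d ∷ ds) a = addV (d ∷ ds) (scaleV a (padV (divideByLinear (d ∷ ds) a)))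

module _ where
  open QISolver using (_⊕_; _⊗_; ⊝_; _⊜_; Κ)
  abstract
    divideByLinear-eval-base : ∀ c z a → c +Q (z *Q 0Q) ≡ (c +Q (a *Q 0Q)) +Q ((z -Q a) *Q 0Q)
    divideByLinear-eval-base = QISolver.solve 3 (λ c z a → (c ⊕ (z ⊗ Κ 0Q)) ⊜ ((c ⊕ (a ⊗ Κ 0Q)) ⊕ ((z ⊕ (⊝ a)) ⊗ Κ 0Q))) refl
    divideByLinear-eval-step : ∀ c z a P Q → c +Q (z *Q (P +Q ((z -Q a) *Q Q))) ≡ (c +Q (a *Q P)) +Q ((z -Q a) *Q ((P +Q ((z -Q a) *Q Q)) +Q (a *Q Q)))
    divideByLinear-eval-step = QISolver.solve 5 (λ c z a P Q → (c ⊕ (z ⊗ (P ⊕ ((z ⊕ (⊝ a)) ⊗ Q)))) ⊜ ((c ⊕ (a ⊗ P)) ⊕ ((z ⊕ (⊝ a)) ⊗ ((P ⊕ ((z ⊕ (⊝ a)) ⊗ Q)) ⊕ (a ⊗ Q))))) refl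
    *Q-zeroʳ : ∀ x → x *Q 0Q ≡ 0Q
    *Q-zeroʳ = QISolver.solve 1 (λ x → (x ⊗ Κ 0Q) ⊜ Κ 0Q) refl

divideByLinear-eval : ∀ {m} (v : Vec QI (suc m)) a z → evalV v z ≡ evalV v a +Q ((z -Q a) *Q evalV (divideByLinear v a) z)
divideByLinear-eval (c ∷ []) a z = divideByLinear-eval-base c z a
divideByLinear-eval (c ∷ d ∷ ds) a z = trans (cong (λ w → c +Q (z *Q w)) (divideByLinear-eval (d ∷ ds) a z))
  (trans (divideByLinear-eval-step c z a P Q) (cong (λ w → (c +Q (a *Q P)) +Q ((z -Q a) *Q w)) (sym e)))
  where
  P = evalV (d ∷ ds) a
  Q = evalV (divideByLinear (d ∷ ds) a) z
  e : evalV (divideByLinear (c ∷ d ∷ ds) a) z ≡ (P +Q ((z -Q a) *Q Q)) +Q (a *Q Q)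
  e = trans (evalV-add (d ∷ ds) (scaleV a (padV (divideByLinear (d ∷ ds) a))) z)
      (cong₂ _+Q_ (divideByLinear-eval (d ∷ ds) a z) (trans (evalV-scale a (padV (divideByLinear (d ∷ ds) a)) z) (cong (a *Q_) (evalV-pad (divideByLinear (d ∷ ds) a) z))))

-- Dividing v by (z - p₀) leaves a polynomial of smaller degree vanishing at the remaining nodes.
vanishes-on-nodes⇒zero : ∀ m (v : Vec QI m) (pts : Fin m → QI) → (∀ i i' → ¬ i ≡ i' → Σ QI λ k → k *Q (pts i -Q pts i') ≡ 1Q) →
                         (∀ i → evalV v (pts i) ≡ 0Q) → ∀ z → evalV v z ≡ 0Q
vanishes-on-nodes⇒zero zero    []  pts invertible v≡0 z = refl
vanishes-on-nodes⇒zero (suc m) v pts invertible v≡0 z = begin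
  evalV v z                                 ≡⟨ divideByLinear-eval v p₀ z ⟩
  evalV v p₀ +Q ((z -Q p₀) *Q evalV q z)    ≡⟨ cong₂ (λ a b → a +Q ((z -Q p₀) *Q b)) (v≡0 zero) q≡0 ⟩
  0Q +Q ((z -Q p₀) *Q 0Q)                   ≡⟨ trans (+Q-identityˡ _) (*Q-zeroʳ (z -Q p₀)) ⟩
  0Q                                        ∎
  where
  open ≡-Reasoning
  p₀ = pts zero
  q = divideByLinear v p₀
  q-at-nodes : ∀ i → evalV q (pts (suc i)) ≡ 0Q
  q-at-nodes i = begin
    evalV q pᵢ                          ≡⟨ sym (*Q-identityˡ _) ⟩
    1Q *Q evalV q pᵢ                    ≡⟨ cong (_*Q evalV q pᵢ) (sym (proj₂ k)) ⟩
    (proj₁ k *Q (pᵢ -Q p₀)) *Q evalV q pᵢ ≡⟨ *Q-assoc (proj₁ k) (pᵢ -Q p₀) (evalV q pᵢ) ⟩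
    proj₁ k *Q ((pᵢ -Q p₀) *Q evalV q pᵢ) ≡⟨ cong (proj₁ k *Q_) factor≡0 ⟩
    proj₁ k *Q 0Q                       ≡⟨ *Q-zeroʳ (proj₁ k) ⟩
    0Q                                  ∎
    where
    pᵢ = pts (suc i)
    k = invertible (suc i) zero (λ ())
    factor≡0 : (pᵢ -Q p₀) *Q evalV q pᵢ ≡ 0Q
    factor≡0 = trans (sym (+Q-identityˡ _)) (trans (cong (_+Q ((pᵢ -Q p₀) *Q evalV q pᵢ)) (sym (v≡0 zero)))
      (trans (sym (divideByLinear-eval v p₀ pᵢ)) (v≡0 (suc i))))
  q≡0 : evalV q z ≡ 0Q
  q≡0 = vanishes-on-nodes⇒zero m q (λ i → pts (suc i)) (λ i i' i≢i' → invertible (suc i) (suc i') (λ e → i≢i' (FP.suc-injective e))) q-at-nodes z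


module _ where
  open QISolver using (_⊕_; _⊗_; ⊝_; _⊜_; Κ)
  abstract
    +Q-exchange : ∀ a b c → a +Q (b +Q c) ≡ b +Q (a +Q c)
    +Q-exchange = QISolver.solve 3 (λ a b c → (a ⊕ (b ⊕ c)) ⊜ (b ⊕ (a ⊕ c))) refl
    x+[-1]x≡0 : ∀ e → e +Q (negQ 1Q *Q e) ≡ 0Q
    x+[-1]x≡0 = QISolver.solve 1 (λ e → (e ⊕ ((⊝ Κ 1Q) ⊗ e)) ⊜ Κ 0Q) refl
    x+[-1]y≡0⇒x≡y : ∀ f l → f +Q (negQ 1Q *Q l) ≡ 0Q → f ≡ l
    x+[-1]y≡0⇒x≡y f l h = trans (QISolver.solve 2 (λ f l → f ⊜ ((f ⊕ ((⊝ Κ 1Q) ⊗ l)) ⊕ l)) refl f l) (trans (cong (_+Q l) h) (+Q-identityˡ l))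



prodQ-cong : ∀ {k} {f g : Fin k → QI} → (∀ i → f i ≡ g i) → prodQ f ≡ prodQ g
prodQ-cong {zero} h = refl
prodQ-cong {suc k} h = cong₂ _*Q_ (h zero) (prodQ-cong (λ i → h (suc i)))

sumQ : ∀ {k} → (Fin k → QI) → QI
sumQ {zero} f = 0Q
sumQ {suc k} f = f zero +Q sumQ (λ i → f (suc i))

sumQ-cong : ∀ {k} {f g : Fin k → QI} → (∀ i → f i ≡ g i) → sumQ f ≡ sumQ g
sumQ-cong {zero} h = refl
sumQ-cong {suc k} h = cong₂ _+Q_ (h zero) (sumQ-cong (λ i → h (suc i)))

sumQ-0 : ∀ k → sumQ {k} (λ _ → 0Q) ≡ 0Q
sumQ-0 zero = refl
sumQ-0 (suc k) = trans (cong (0Q +Q_) (sumQ-0 k)) (+Q-identityˡ 0Q)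

sumQ-punch : ∀ {n} (j : Fin (suc n)) (f : Fin (suc n) → QI) → sumQ f ≡ f j +Q sumQ (λ i → f (punchIn j i))
sumQ-punch zero f = refl
sumQ-punch {zero} (suc ()) f
sumQ-punch {suc n} (suc j) f = trans (cong (f zero +Q_) (sumQ-punch j (λ i → f (suc i)))) (+Q-exchange (f zero) (f (suc j)) _)

sumQ-delta : ∀ {n} (i : Fin (suc n)) (F : Fin (suc n) → QI) → (∀ j → ¬ j ≡ i → F j ≡ 0Q) → sumQ F ≡ F i
sumQ-delta i F h = trans (sumQ-punch i F) (trans (cong (F i +Q_) (trans (sumQ-cong (λ k → h (punchIn i k) (FP.punchInᵢ≢i i k))) (sumQ-0 _))) (+Q-identityʳ (F i)))

sumG : ∀ {k} → (Fin k → GI) → GI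
sumG {zero} f = 0G
sumG {suc k} f = f zero +G sumG (λ i → f (suc i))

embed-sum : ∀ {k} (f : Fin k → GI) → embed (sumG f) ≡ sumQ (λ i → embed (f i))
embed-sum {zero} f = refl
embed-sum {suc k} f = trans (embed-+ (f zero) _) (cong (embed (f zero) +Q_) (embed-sum (λ i → f (suc i))))

zerosV : ∀ m → Vec QI m
zerosV zero = []
zerosV (suc m) = 0Q ∷ zerosV m

evalV-zeros : ∀ m z → evalV (zerosV m) z ≡ 0Q
evalV-zeros zero z = refl
evalV-zeros (suc m) z = trans (cong (λ w → 0Q +Q (z *Q w)) (evalV-zeros m z)) (qid3' z)
  where
  qid3' : ∀ z → 0Q +Q (z *Q 0Q) ≡ 0Q
  qid3' z = trans (+Q-identityˡ _) (*Q-zeroʳ z)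

sumV : ∀ {k m} → (Fin k → Vec QI m) → Vec QI m
sumV {zero} {m} F = zerosV m
sumV {suc k} F = addV (F zero) (sumV (λ i → F (suc i)))

evalV-sum : ∀ {k m} (F : Fin k → Vec QI m) z → evalV (sumV F) z ≡ sumQ (λ i → evalV (F i) z)
evalV-sum {zero} {m} F z = evalV-zeros m z
evalV-sum {suc k} F z = trans (evalV-add (F zero) _ z) (cong (evalV (F zero) z +Q_) (evalV-sum (λ i → F (suc i)) z))


-- Lagrange interpolation

module Lagrange {n} (C : Fin (suc n) → GI) (C-injective : Injective _≡_ _≡_ C) where
  π-node≢0 : ∀ j → ¬ π C j (C j) ≡ 0G
  π-node≢0 = π-at-node-nonzero C C-injective

  1/π-node : Fin (suc n) → QI
  1/π-node j = invQ (π C j (C j)) (π-node≢0 j)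

  -- The j-th Lagrange basis polynomial ℓ j x = π C j x / π C j (C j).
  ℓ : Fin (suc n) → Poly n
  ℓ j = scaleV (1/π-node j) (prodLin (λ i → embed (C (punchIn j i))))

  eval-ℓ : ∀ j x → evalV (ℓ j) (embed x) ≡ 1/π-node j *Q embed (π C j x)
  eval-ℓ j x = trans (evalV-scale _ _ (embed x)) (cong (1/π-node j *Q_)
    (trans (evalV-prodLin _ (embed x)) (trans (prodQ-cong (λ i → sym (embed-- x (C (punchIn j i))))) (sym (embed-prod (λ i → x -G C (punchIn j i)))))))

  ℓ-at-node : ∀ j → evalV (ℓ j) (embed (C j)) ≡ embed 1G
  ℓ-at-node j = trans (eval-ℓ j (C j)) (invQ-inverseˡ (π C j (C j)) (π-node≢0 j))

  ℓ-at-other-node : ∀ j i → ¬ i ≡ j → evalV (ℓ j) (embed (C i)) ≡ embed 0G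
  ℓ-at-other-node j i i≢j = trans (eval-ℓ j (C i)) (trans (cong (λ w → 1/π-node j *Q embed w) (π-at-other-node C j i i≢j)) (*Q-zeroʳ (1/π-node j)))

  -- ℓ j is integer-valued on C, so on all of ℤ[i]; multiplying back by π C j (C j) gives the quotient.
  universal⇒lagrangeDivisible : Universal n (Image C) → LagrangeDivisible C
  universal⇒lagrangeDivisible universal j x = divides w (embed-inj πx≡πw)
    where
    D = π C j (C j)
    integral-on-C : ∀ z → Image C z → InGI (eval (ℓ j) z)
    integral-on-C z (i , refl) with i FP.≟ j
    ... | yes refl = 1G , sym (ℓ-at-node j)
    ... | no i≢j   = 0G , sym (ℓ-at-other-node j i i≢j)
    ℓx = universal (ℓ j) integral-on-C x
    w = proj₁ ℓx
    πx≡πw : embed (π C j x) ≡ embed (D *G w)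
    πx≡πw = sym (trans (embed-* D w) (trans (cong (embed D *Q_) (trans (proj₂ ℓx) (eval-ℓ j x)))
      (trans (reassociate (embed D) (1/π-node j) (embed (π C j x)))
        (trans (cong (_*Q embed (π C j x)) (invQ-inverseˡ D (π-node≢0 j))) (*Q-identityˡ _)))))
      where
      reassociate : ∀ d k p → d *Q (k *Q p) ≡ (k *Q d) *Q p
      reassociate d k p = trans (sym (*Q-assoc d k p)) (cong (_*Q p) (*Q-comm d k))

  -- f agrees on C with Σ_j f (C j) ℓ j; the difference has degree ≤ n and n + 1 roots, so it vanishes,
  -- and each f (C j) ℓ j x = f (C j) · π C j x / π C j (C j) is a Gaussian integer.
  lagrangeDivisible⇒universal : LagrangeDivisible C → Universal n (Image C)
  lagrangeDivisible⇒universal divisible f integral-on-C z = sumG G , sym f≡ΣG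
    where
    wj : Fin (suc n) → GI
    wj j = proj₁ (integral-on-C (C j) (j , refl))
    ewj : ∀ j → embed (wj j) ≡ eval f (C j)
    ewj j = proj₂ (integral-on-C (C j) (j , refl))
    interpolant : Vec QI (suc n)
    interpolant = sumV (λ j → scaleV (embed (wj j)) (ℓ j))
    g : Vec QI (suc n)
    g = addV f (scaleV (negQ 1Q) interpolant)
    eval-interpolant : ∀ y → evalV interpolant y ≡ sumQ (λ j → embed (wj j) *Q evalV (ℓ j) y)
    eval-interpolant y = trans (evalV-sum (λ j → scaleV (embed (wj j)) (ℓ j)) y) (sumQ-cong (λ j → evalV-scale (embed (wj j)) (ℓ j) y))
    eval-g : ∀ y → evalV g y ≡ evalV f y +Q (negQ 1Q *Q evalV interpolant y)
    eval-g y = trans (evalV-add f _ y) (cong (evalV f y +Q_) (evalV-scale (negQ 1Q) interpolant y))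
    interpolant-at-node : ∀ i → evalV interpolant (embed (C i)) ≡ embed (wj i)
    interpolant-at-node i = trans (eval-interpolant (embed (C i)))
      (trans (sumQ-delta i _ (λ j j≢i → trans (cong (embed (wj j) *Q_) (ℓ-at-other-node j i (λ e → j≢i (sym e)))) (*Q-zeroʳ (embed (wj j)))))
        (trans (cong (embed (wj i) *Q_) (ℓ-at-node i)) (*Q-identityʳ _)))
    g-at-node : ∀ i → evalV g (embed (C i)) ≡ 0Q
    g-at-node i = trans (eval-g (embed (C i))) (trans (cong₂ (λ a b → a +Q (negQ 1Q *Q b)) (sym (ewj i)) (interpolant-at-node i)) (x+[-1]x≡0 (embed (wj i))))
    differences-invertible : ∀ i i' → ¬ i ≡ i' → Σ QI λ k → k *Q (embed (C i) -Q embed (C i')) ≡ 1Q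
    differences-invertible i i' i≢i' = invQ (C i -G C i') Ci-Ci'≢0 , trans (cong (invQ (C i -G C i') Ci-Ci'≢0 *Q_) (sym (embed-- (C i) (C i')))) (invQ-inverseˡ _ Ci-Ci'≢0)
      where
      Ci-Ci'≢0 : ¬ (C i -G C i') ≡ 0G
      Ci-Ci'≢0 e = i≢i' (C-injective (x-y≡0⇒x≡y _ _ e))
    g≡0 : evalV g (embed z) ≡ 0Q
    g≡0 = vanishes-on-nodes⇒zero (suc n) g (λ i → embed (C i)) differences-invertible g-at-node (embed z)
    q : Fin (suc n) → GI
    q j = _∣_.quotient (divisible j z)
    G : Fin (suc n) → GI
    G j = wj j *G q j
    term : ∀ j → embed (wj j) *Q evalV (ℓ j) (embed z) ≡ embed (G j)
    term j = trans (cong (embed (wj j) *Q_) (trans (eval-ℓ j z) (trans (cong (λ t → 1/π-node j *Q embed t) (_∣_.equality (divisible j z)))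
      (trans (cong (1/π-node j *Q_) (embed-* (π C j (C j)) (q j))) (trans (sym (*Q-assoc (1/π-node j) (embed (π C j (C j))) (embed (q j))))
        (trans (cong (_*Q embed (q j)) (invQ-inverseˡ (π C j (C j)) (π-node≢0 j))) (*Q-identityˡ _)))))))
      (sym (embed-* (wj j) (q j)))
    f≡ΣG : eval f z ≡ embed (sumG G)
    f≡ΣG = trans (x+[-1]y≡0⇒x≡y (evalV f (embed z)) (evalV interpolant (embed z)) (trans (sym (eval-g (embed z))) g≡0))
      (trans (eval-interpolant (embed z)) (trans (sumQ-cong term) (sym (embed-sum G))))

  universal⇔lagrangeDivisible : Universal n (Image C) ⇔ LagrangeDivisible C
  universal⇔lagrangeDivisible = mk⇔ universal⇒lagrangeDivisible lagrangeDivisible⇒universal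

AlmostUniformModPrimePowers : ∀ {k} → (Fin k → GI) → Set
AlmostUniformModPrimePowers x = ∀ p → IsPrime p → ∀ h → 1 ≤ h → AlmostUniform x (p ^G h)

-- Modulo p^0 = 1 there is a single class, so level 0 is almost uniform for free.
almostUniformCounts-all-levels : ∀ {k} (x : Fin k → GI) p → (∀ h → 1 ≤ h → AlmostUniform x (p ^G h)) → ∀ h → AlmostUniformCounts x (p ^G h)
almostUniformCounts-all-levels {k} x p _ zero r s = subst₂ (λ a b → a ℕ.≤ suc b) (sym (count-level0 x p r)) (sym (count-level0 x p s)) (ℕP.n≤1+n k)
almostUniformCounts-all-levels x p uniform (suc h) = almostUniform⇒counts x (p ^G suc h) (uniform (suc h) (s≤s z≤n))

lagrangeDivisible⇔almostUniform : ∀ {n} (C : Fin (suc n) → GI) → Injective _≡_ _≡_ C → LagrangeDivisible C ⇔ AlmostUniformModPrimePowers C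
lagrangeDivisible⇔almostUniform C C-injective = mk⇔
  (λ divisible p p-prime h _ → counts⇒almostUniform C (p ^G h) (lagrangeDivisible⇒almostUniform p p-prime C C-injective divisible h))
  (λ uniform j x → prime-powers⇒∣ (π C j (C j)) (π C j x) (π-at-node-nonzero C C-injective j)
    (λ p p-prime → almostUniform⇒π-∣ p p-prime C C-injective (almostUniformCounts-all-levels C p (uniform p p-prime)) j x))

vol-nonzero : ∀ {k} (x : Fin k → GI) → Injective _≡_ _≡_ x → ¬ vol x ≡ 0G
vol-nonzero {zero}  x _ ()
vol-nonzero {suc k} x x-injective = *G-nonzero _ _
  (prodG-nonzero (λ j → x zero -G x (suc j)) (λ j e → zero≢suc (x-injective (x-y≡0⇒x≡y _ _ e))))
  (vol-nonzero (λ j → x (suc j)) (λ e → FP.suc-injective (x-injective e)))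
  where
  zero≢suc : ∀ {k} {j : Fin k} → ¬ (zero ≡ suc j)
  zero≢suc ()

universal⇔almostUniform : ∀ n (C : Fin (suc n) → GI) → Injective _≡_ _≡_ C → Universal n (Image C) ⇔ AlmostUniformModPrimePowers C
universal⇔almostUniform n C C-injective =
  ⇔-trans (Lagrange.universal⇔lagrangeDivisible C C-injective) (lagrangeDivisible⇔almostUniform C C-injective)

almostUniform⇒vol-∣ : ∀ {n} (C B : Fin (suc n) → GI) → Injective _≡_ _≡_ C → Injective _≡_ _≡_ B →
                      AlmostUniformModPrimePowers C → vol C ∣ vol B
almostUniform⇒vol-∣ C B C-injective B-injective uniform = prime-powers⇒∣ (vol C) (vol B) (vol-nonzero C C-injective)
  (λ p p-prime → VolumeComparison.^G-∣vol p p-prime C B C-injective B-injective (almostUniformCounts-all-levels C p (uniform p p-prime)))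

almostUniform-associate : ∀ {n} (C B : Fin (suc n) → GI) → Injective _≡_ _≡_ C → Injective _≡_ _≡_ B →
                          AlmostUniformModPrimePowers C → ∀ u → IsUnit u → vol B ≡ vol C *G u → AlmostUniformModPrimePowers B
almostUniform-associate C B C-injective B-injective uniform u u-unit B≡Cu p p-prime h 1≤h = counts⇒almostUniform B (p ^G h)
  (VolumeComparison.associate⇒almostUniform p p-prime C B C-injective B-injective (almostUniformCounts-all-levels C p (uniform p p-prime)) u u-unit B≡Cu h 1≤h)

∣-equal-norm⇒unit : ∀ {a b} → (d : a ∣ b) → ¬ a ≡ 0G → ∥ b ∥ ≡ ∥ a ∥ → IsUnit (_∣_.quotient d)
∣-equal-norm⇒unit {a} (divides u refl) a≢0 ∥au∥≡∥a∥ = ∥u∥≡1⇒unit u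
  (ℕP.*-cancelˡ-≡ (∥ u ∥) 1 (∥ a ∥) {{ℕ.≢-nonZero (λ e → a≢0 (∥x∥≡0⇒x≡0 a e))}}
    (trans (sym (∥∥-*G a u)) (trans ∥au∥≡∥a∥ (sym (ℕP.*-identityʳ _)))))

lemma1 : ∀ (n : ℕ) (C : Fin (suc n) → GI) → Injective _≡_ _≡_ C →
    (Universal n (Image C) ⇔ (∀ (p : GI) → IsPrime p → ∀ (k : ℕ) → 1 ≤ k → AlmostUniform C (p ^G k)))
    × (Universal n (Image C) →
    ∀ (B : Fin (suc n) → GI) → Injective _≡_ _≡_ B →
    (norm (vol C) ℤ.≤ norm (vol B))
    × (vol C ∣G vol B)
    × (norm (vol B) ≡ norm (vol C) → Universal n (Image B)))
lemma1 n C C-injective = C-universal⇔ , λ C-universal B B-injective →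
  let C-uniform = Equivalence.to C-universal⇔ C-universal
      C∣B = almostUniform⇒vol-∣ C B C-injective B-injective C-uniform
  in subst₂ ℤ._≤_ (+∥x∥≡norm (vol C)) (+∥x∥≡norm (vol B)) (ℤ.+≤+ (∣⇒∥∥≤ C∣B (vol-nonzero B B-injective)))
   , ∣⇒∣G C∣B
   , λ norm-B≡norm-C → Equivalence.from (universal⇔almostUniform n B B-injective)
       (almostUniform-associate C B C-injective B-injective C-uniform (_∣_.quotient C∣B)
         (∣-equal-norm⇒unit C∣B (vol-nonzero C C-injective) (ℤP.+-injective (trans (+∥x∥≡norm (vol B)) (trans norm-B≡norm-C (sym (+∥x∥≡norm (vol C)))))))
         (_∣_.equality C∣B))
  where
  C-universal⇔ = universal⇔almostUniform n C C-injective
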